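{- Let $n\ge 1$ and $k,m\ge 0$ be integers. The map $\phi$ defined below is a bijection from $\mathcal{C}_n^k(m,R*)$ onto $\mathcal{C}_{n-1}^{k+1}(m,*)\setminus\mathcal{C}_{n-1}^{k+1}(m,*,|m')$, where $m'=m+k+1$.
   Context: Blue and red are two distinct colours. For integers $m,k,n\ge0$, the blue ground set is $K=\{m+1,\dots,m+k\}\cup\{*_b\}$ and the red ground set is $N=\{m+1,\dots,m+n\}\cup\{*_r\}$. A (shifted) Callan sequence of size $k\times n$ is a sequence of pairs $(B_1,R_1)\cdots(B_r,R_r)(B^*,R^*)$, $r\ge0$, such that $\{B_1,\dots,B_r,B^*\}$ is a set partition of $K$ into $r+1$ nonempty blocks with $*_b\in B^*$, and $\{R_1,\dots,R_r,R^*\}$ is a set partition of $N$ into $r+1$ nonempty blocks with $*_r\in R^*$; $(B_i,R_i)$ are ordinary pairs, $(B^*,R^*)$ is the extra pair, $B^*,R^*$ the extra blocks. An $m$-barred Callan sequence of size $k\times n$ is a linear arrangement of $m$ blue bars labelled $1,\dots,m$, $m+1$ red bars labelled $0,\dots,m$, and the pairs of a shifted Callan sequence of size $k\times n$ in the order of that Callan sequence, such that every blue bar with label $i$ is immediately followed by a bar with label strictly smaller than $i$, and every red bar with label $i$ is immediately followed either by a Callan pair or by a bar with label strictly greater than $i$. Let $\mathcal{C}_n^k(m)$ be the set of these. The group of bars of a Callan pair is the maximal (possibly empty) run of consecutive bars immediately to its left. $\mathcal{C}_n^k(m,*)$ is the subset of $\mathcal{C}_n^k(m)$ where $R^*=\{*_r\}$;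 $\mathcal{C}_n^k(m,R*)=\mathcal{C}_n^k(m)\setminus\mathcal{C}_n^k(m,*)$. For $k\ge1$, $\mathcal{C}_n^k(m,*,|m+k)$ is the subset of $\mathcal{C}_n^k(m,*)$ of sequences in which the maximal blue element $m+k$ forms by itself the blue block of an ordinary pair, and this pair is immediately preceded by at least one bar; for $k=0$ this set is empty by convention. Definition of $\phi$ on $\alpha\in\mathcal{C}_n^k(m,R*)$ (remove the red element $m+n$, add the new blue element $m'=m+k+1$): (A1) if $R^*=\{m+n,*_r\}$: delete $m+n$ (so $R^*$ becomes $\{*_r\}$) and add $m'$ to the blue block of the first Callan pair of the sequence. (A2) if $m+n\in R^*$ and $R'=R^*\setminus\{m+n,*_r\}\ne\varnothing$: replace $R^*$ by $\{*_r\}$ and place the new pair $(\{m'\},R')$ at the very beginning of the sequence. (B1) if some ordinary pair has $R_i=\{m+n\}$: replace $R^*$ by $\{*_r\}$, replace $R_i$ by $R^*\setminus\{*_r\}$ (the old extra red block without $*_r$), move the pair $(B_i,R^*\setminus\{*_r\})$ together with its group of bars to the very beginning of the sequence, and add $m'$ to the blue block of the pair that immediately followed $(B_i,R_i)$ among the pairs of $\alpha$ (this is $B_{i+1}$, or $B^*$ if $i=r$). (B2) if $m+n\in R_i$ for an ordinary pair with $R'=R_i\setminus\{m+n\}\neq\varnothing$: replace $R^*$ by $\{*_r\}$, replace $(B_i,R_i)$ by the two consecutive pairs $(B_i,R^*\setminus\{*_r\})(\{m'\},R')$, then move $(B_i,R^*\setminus\{*_r\})$ together with its group of bars to the very beginning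 of the sequence. -}

module Defs where

open import Data.Nat using (ℕ; zero; suc; _+_; _<_; _≡ᵇ_)
open import Data.Bool using (Bool; true; false; if_then_else_; not)
open import Data.List using (List; []; _∷_; _++_; map; concat; upTo; reverse; filterᵇ)
open import Data.List.Relation.Unary.All using (All)
open import Data.List.Relation.Unary.Linked using (Linked)
open import Data.List.Relation.Binary.Permutation.Propositional using (_↭_)
open import Data.Product using (Σ; _×_; _,_; ∃)
open import Data.Unit using (⊤)
open import Data.Empty using (⊥)
open import Relation.Binary.PropositionalEquality using (_≡_)
open import Relation.Nullary using (¬_)

-- Items of an m-barred Callan sequence, written left to right.
--   bbar i      : blue bar with label i
--   rbar i      : red bar with label i
--   opair B R   : ordinary Callan pair (B_i , R_i)
--   xpair B R   : the extra pair (B* , R*), where B and R are the extra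
--                 blocks WITHOUT *_b resp. *_r (so R = [] means R* = {*_r}).
-- Blocks are lists of naturals required to be strictly increasing, so each
-- set has a unique (canonical) representation.

data Item : Set where
  bbar  : ℕ → Item
  rbar  : ℕ → Item
  opair : List ℕ → List ℕ → Item
  xpair : List ℕ → List ℕ → Item

ShapeAfter : List Item → Set
ShapeAfter []            = ⊤
ShapeAfter (bbar _ ∷ s)  = ShapeAfter s
ShapeAfter (rbar _ ∷ s)  = ShapeAfter s
ShapeAfter (opair _ _ ∷ s) = ⊥
ShapeAfter (xpair _ _ ∷ s) = ⊥

Shape : List Item → Set
Shape []              = ⊥
Shape (bbar _ ∷ s)    = Shape s
Shape (rbar _ ∷ s)    = Shape s
Shape (opair _ _ ∷ s) = Shape s
Shape (xpair _ _ ∷ s) = ShapeAfter s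

bbarLabels : List Item → List ℕ
bbarLabels []              = []
bbarLabels (bbar i ∷ s)    = i ∷ bbarLabels s
bbarLabels (rbar _ ∷ s)    = bbarLabels s
bbarLabels (opair _ _ ∷ s) = bbarLabels s
bbarLabels (xpair _ _ ∷ s) = bbarLabels s

rbarLabels : List Item → List ℕ
rbarLabels []              = []
rbarLabels (bbar _ ∷ s)    = rbarLabels s
rbarLabels (rbar i ∷ s)    = i ∷ rbarLabels s
rbarLabels (opair _ _ ∷ s) = rbarLabels s
rbarLabels (xpair _ _ ∷ s) = rbarLabels s

blueBlocks : List Item → List (List ℕ)
blueBlocks []              = []
blueBlocks (bbar _ ∷ s)    = blueBlocks s
blueBlocks (rbar _ ∷ s)    = blueBlocks s
blueBlocks (opair B _ ∷ s) = B ∷ blueBlocks s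
blueBlocks (xpair B _ ∷ s) = B ∷ blueBlocks s

redBlocks : List Item → List (List ℕ)
redBlocks []              = []
redBlocks (bbar _ ∷ s)    = redBlocks s
redBlocks (rbar _ ∷ s)    = redBlocks s
redBlocks (opair _ R ∷ s) = R ∷ redBlocks s
redBlocks (xpair _ R ∷ s) = R ∷ redBlocks s

ordBlue : List Item → List (List ℕ)
ordBlue []              = []
ordBlue (bbar _ ∷ s)    = ordBlue s
ordBlue (rbar _ ∷ s)    = ordBlue s
ordBlue (opair B _ ∷ s) = B ∷ ordBlue s
ordBlue (xpair _ _ ∷ s) = ordBlue s

ordRed : List Item → List (List ℕ)
ordRed []              = []
ordRed (bbar _ ∷ s)    = ordRed s
ordRed (rbar _ ∷ s)    = ordRed s
ordRed (opair _ R ∷ s) = R ∷ ordRed s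
ordRed (xpair _ _ ∷ s) = ordRed s

xRed : List Item → List ℕ
xRed []              = []
xRed (bbar _ ∷ s)    = xRed s
xRed (rbar _ ∷ s)    = xRed s
xRed (opair _ _ ∷ s) = xRed s
xRed (xpair _ R ∷ s) = R

NonEmpty : List ℕ → Set
NonEmpty xs = ¬ (xs ≡ [])

BlueNext : ℕ → List Item → Set
BlueNext i []              = ⊥
BlueNext i (bbar j ∷ _)    = j < i
BlueNext i (rbar j ∷ _)    = j < i
BlueNext i (opair _ _ ∷ _) = ⊥
BlueNext i (xpair _ _ ∷ _) = ⊥

RedNext : ℕ → List Item → Set
RedNext i []              = ⊥
RedNext i (bbar j ∷ _)    = i < j
RedNext i (rbar j ∷ _)    = i < j
RedNext i (opair _ _ ∷ _) = ⊤
RedNext i (xpair _ _ ∷ _) = ⊤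

BarsOK : List Item → Set
BarsOK []              = ⊤
BarsOK (bbar i ∷ s)    = BlueNext i s × BarsOK s
BarsOK (rbar i ∷ s)    = RedNext i s × BarsOK s
BarsOK (opair _ _ ∷ s) = BarsOK s
BarsOK (xpair _ _ ∷ s) = BarsOK s

range : ℕ → ℕ → List ℕ
range m k = map (λ i → m + suc i) (upTo k)

record C (m k n : ℕ) (s : List Item) : Set where
  field
    shape        : Shape s
    blueBarsOK   : bbarLabels s ↭ map suc (upTo m)
    redBarsOK    : rbarLabels s ↭ upTo (suc m)
    barsOK       : BarsOK s
    blueCover    : concat (blueBlocks s) ↭ range m k
    redCover     : concat (redBlocks s) ↭ range m n
    blueSorted   : All (Linked _<_) (blueBlocks s)
    redSorted    : All (Linked _<_) (redBlocks s)
    blueNonEmpty : All NonEmpty (ordBlue s)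
    redNonEmpty  : All NonEmpty (ordRed s)

CStar : ℕ → ℕ → ℕ → List Item → Set
CStar m k n s = C m k n s × xRed s ≡ []

CRStar : ℕ → ℕ → ℕ → List Item → Set
CRStar m k n s = C m k n s × ¬ (xRed s ≡ [])

IsBar : Item → Set
IsBar (bbar _)    = ⊤
IsBar (rbar _)    = ⊤
IsBar (opair _ _) = ⊥
IsBar (xpair _ _) = ⊥

CStarBar : ℕ → ℕ → ℕ → List Item → Set
CStarBar m zero    n s = ⊥
CStarBar m (suc k) n s =
  CStar m (suc k) n s ×
  Σ (List Item) λ xs → Σ Item λ b → Σ (List ℕ) λ R → Σ (List Item) λ ys →
    IsBar b × s ≡ xs ++ b ∷ opair ((m + suc k) ∷ []) R ∷ ys

isBar : Item → Bool
isBar (bbar _)    = true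
isBar (rbar _)    = true
isBar (opair _ _) = false
isBar (xpair _ _) = false

elemᵇ : ℕ → List ℕ → Bool
elemᵇ x []       = false
elemᵇ x (y ∷ ys) = if x ≡ᵇ y then true else elemᵇ x ys

removeᵇ : ℕ → List ℕ → List ℕ
removeᵇ x = filterᵇ (λ y → not (x ≡ᵇ y))

null : List ℕ → Bool
null []      = true
null (_ ∷ _) = false

clearX : List Item → List Item
clearX []              = []
clearX (xpair B _ ∷ s) = xpair B [] ∷ clearX s
clearX (i ∷ s)         = i ∷ clearX s

addFirst : ℕ → List Item → List Item
addFirst x []              = []
addFirst x (opair B R ∷ s) = opair (B ++ x ∷ []) R ∷ s
addFirst x (xpair B R ∷ s) = xpair (B ++ x ∷ []) R ∷ s
addFirst x (i ∷ s)         = i ∷ addFirst x s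

record Split : Set where
  constructor mkSplit
  field
    pre  : List Item
    blk  : List ℕ
    red  : List ℕ
    post : List Item

findPair : ℕ → List Item → Split
findPair x [] = mkSplit [] [] [] []
findPair x (opair B R ∷ s) with elemᵇ x R
... | true  = mkSplit [] B R s
... | false = let mkSplit p b r q = findPair x s in mkSplit (opair B R ∷ p) b r q
findPair x (i ∷ s) = let mkSplit p b r q = findPair x s in mkSplit (i ∷ p) b r q

takeWhileRev : List Item → List Item × List Item
takeWhileRev []      = [] , []
takeWhileRev (i ∷ s) with isBar i
... | true  = let (g , r) = takeWhileRev s in g ++ i ∷ [] , r
... | false = [] , i ∷ s

trailingBars : List Item → List Item × List Item
trailingBars pre = let (g , r) = takeWhileRev (reverse pre) in reverse r , g

-- φ for parameters m k n (n ≥ 1): removes red element m+n, adds blue m' = m+k+1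
phi : ℕ → ℕ → ℕ → List Item → List Item
phi m k n α =
  if elemᵇ mn (xRed α)
  then (if null R'x
        then clearX (addFirst m' α)
        else opair (m' ∷ []) R'x ∷ clearX α)
  else (let mkSplit pre B Ri post = findPair mn α
            (pre' , grp) = trailingBars pre
            R' = removeᵇ mn Ri
        in if null R'
           then grp ++ opair B Rs ∷ pre' ++ clearX (addFirst m' post)
           else grp ++ opair B Rs ∷ pre' ++ opair (m' ∷ []) R' ∷ clearX post)
  where
    mn  = m + n
    m'  = m + suc k
    Rs  = xRed α
    R'x = removeᵇ mn Rs

-- An m-barred Callan sequence is cut into a layout: segments, each a (possibly empty) group
-- of bars followed by an ordinary pair, then the group and the extra pair, then trailing bars.
-- Membership in 𝒞ₙᵏ(m) becomes a condition on three lists read off the layout (its groups,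
-- its blue blocks and its red blocks) together with non-emptiness of the ordinary blocks.
-- Each rule of φ acts on these lists by a few local moves: appending the new maximum m' to
-- one blue block, removing the maximum m+n from one red block, inserting an empty block and
-- moving a segment to the front. Every move preserves validity in both directions, so φ maps
-- 𝒞(m,R*) into 𝒞(m,*), and a target is hit by undoing the rule indicated by the first pair
-- whose blue block contains m'. The pairs {m'} created by φ carry no bars; this keeps the
-- images out of 𝒞(m,*,|m') and makes that reading of the rule unambiguous, so φ is injective.

{-# OPTIONS --safe #-}
module Submission where

open import Data.Bool using (true; false; T; if_then_else_)
open import Data.Bool.Properties using (¬-not; T-≡)
open import Data.Nat using (ℕ; suc; _+_; _<_; _≤_; _≡ᵇ_; s≤s; s≤s⁻¹)
open import Data.Nat.Properties using (≡ᵇ⇒≡; ≡⇒≡ᵇ; <-irrefl; <-trans; +-suc; +-monoʳ-<; ≤⇒≯)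
open import Data.List using (List; []; _∷_; _++_; _∷ʳ_; [_]; map; concat; concatMap; upTo; reverse)
open import Data.List.Properties
  using (map-++; upTo-∷ʳ; ++-assoc; ++-identityʳ; reverse-++; reverse-involutive; unfold-reverse; ∷ʳ-injectiveˡ)
open import Data.List.Membership.Propositional using (_∈_; _∉_)
open import Data.List.Membership.Propositional.Properties using (∈-++⁺ʳ; ∈-concat⁻; ∈-∃++)
open import Data.List.Relation.Unary.Any using (Any; here; there)
import Data.List.Relation.Unary.Any.Properties as Any
open import Data.List.Relation.Unary.All as All using (All; []; _∷_)
import Data.List.Relation.Unary.All.Properties as All
open import Data.List.Relation.Unary.Linked using (Linked; []; [-]; _∷_)
open import Data.List.Relation.Unary.Linked.Properties using (Linked⇒All)
open import Data.List.Relation.Binary.Permutation.Propositional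
  using (_↭_; ↭-refl; ↭-sym; ↭-trans; ↭-reflexive; module PermutationReasoning)
import Data.List.Relation.Binary.Permutation.Propositional as Perm
open import Data.List.Relation.Binary.Permutation.Propositional.Properties
  using (All-resp-↭; ∈-resp-↭; ++⁺ˡ; ++⁺ʳ; shift; shifts; ∷↭∷ʳ; drop-∷; map⁺)
open import Data.Unit using (⊤)
open import Data.Empty using (⊥)
open import Data.Product using (Σ; _×_; _,_; proj₁; proj₂; ∃₂)
import Data.Product as Product
open import Data.Sum using (_⊎_; inj₁; inj₂)
import Data.Sum as Sum
open import Function using (_∘_; _⇔_; mk⇔; Equivalence)
open import Function.Construct.Composition using (_⇔-∘_)
open import Function.Properties.Equivalence using (⇔-setoid)
open import Level using (0ℓ)
import Relation.Binary.Reasoning.Setoid as SetoidReasoning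
open Equivalence using (to; from)
open import Relation.Binary.PropositionalEquality hiding ([_])
open import Relation.Nullary using (¬_; contradiction)

open import Defs

module ⇔-Reasoning = SetoidReasoning (⇔-setoid 0ℓ)

private
  ≡ᵇ-true⇒≡ : ∀ {x y} → (x ≡ᵇ y) ≡ true → x ≡ y
  ≡ᵇ-true⇒≡ {x} {y} e = ≡ᵇ⇒≡ x y (from T-≡ e)

  ≡ᵇ-refl : ∀ x → (x ≡ᵇ x) ≡ true
  ≡ᵇ-refl x = to T-≡ (≡⇒≡ᵇ x x refl)

  ≢⇒≡ᵇ-false : ∀ {x y} → x ≢ y → (x ≡ᵇ y) ≡ false
  ≢⇒≡ᵇ-false x≢y = ¬-not (x≢y ∘ ≡ᵇ-true⇒≡)

  ≡ᵇ-false⇒≢ : ∀ {x y} → (x ≡ᵇ y) ≡ false → x ≢ y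
  ≡ᵇ-false⇒≢ {x} {y} e x≡y = subst T e (≡⇒≡ᵇ x y x≡y)

elemᵇ⇒∈ : ∀ {x} xs → elemᵇ x xs ≡ true → x ∈ xs
elemᵇ⇒∈ {x} (y ∷ ys) e with x ≡ᵇ y in x≡ᵇy
... | true  = here (≡ᵇ-true⇒≡ x≡ᵇy)
... | false = there (elemᵇ⇒∈ ys e)

∈⇒elemᵇ : ∀ {x xs} → x ∈ xs → elemᵇ x xs ≡ true
∈⇒elemᵇ {x} (here refl) rewrite ≡ᵇ-refl x = refl
∈⇒elemᵇ {x} {y ∷ _} (there x∈ys) with x ≡ᵇ y
... | true  = refl
... | false = ∈⇒elemᵇ x∈ys

∉⇒¬elemᵇ : ∀ {x xs} → x ∉ xs → elemᵇ x xs ≡ false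
∉⇒¬elemᵇ {xs = xs} x∉xs = ¬-not (x∉xs ∘ elemᵇ⇒∈ xs)

¬elemᵇ⇒∉ : ∀ {x xs} → elemᵇ x xs ≡ false → x ∉ xs
¬elemᵇ⇒∉ x∉xs x∈xs = contradiction (trans (sym (∈⇒elemᵇ x∈xs)) x∉xs) λ ()

null⇒≡[] : ∀ {xs} → null xs ≡ true → xs ≡ []
null⇒≡[] {[]} _ = refl

¬null⇒≢[] : ∀ {xs} → null xs ≡ false → xs ≢ []
¬null⇒≢[] {_ ∷ _} _ ()

≢[]⇒¬null : ∀ {xs} → xs ≢ [] → null xs ≡ false
≢[]⇒¬null {[]}    xs≢[] = contradiction refl xs≢[]
≢[]⇒¬null {_ ∷ _} _     = refl

∷ʳ-nonEmpty : ∀ {y : ℕ} xs → NonEmpty (xs ∷ʳ y)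
∷ʳ-nonEmpty []      ()
∷ʳ-nonEmpty (_ ∷ _) ()

∈-∷ʳ : ∀ (y : ℕ) xs → y ∈ xs ∷ʳ y
∈-∷ʳ y xs = ∈-++⁺ʳ xs (here refl)

∉-bounded : ∀ {x xs} → All (_< x) xs → x ∉ xs
∉-bounded xs<x x∈xs = <-irrefl refl (All.lookup xs<x x∈xs)

Sorted : List ℕ → Set
Sorted = Linked _<_

sorted-∷ʳ : ∀ {x xs} → Sorted xs → All (_< x) xs → Sorted (xs ∷ʳ x)
sorted-∷ʳ []            []                = [-]
sorted-∷ʳ [-]           (y<x ∷ [])        = y<x ∷ [-]
sorted-∷ʳ (y<z ∷ sorted) (_ ∷ rest<x)     = y<z ∷ sorted-∷ʳ sorted rest<x

sorted-∷ʳ⁻ : ∀ {x} xs → Sorted (xs ∷ʳ x) → Sorted xs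
sorted-∷ʳ⁻ []           _              = []
sorted-∷ʳ⁻ (_ ∷ [])     _              = [-]
sorted-∷ʳ⁻ (_ ∷ _ ∷ xs) (y<z ∷ sorted) = y<z ∷ sorted-∷ʳ⁻ (_ ∷ xs) sorted

sorted-tail : ∀ {y ys} → Sorted (y ∷ ys) → Sorted ys
sorted-tail [-]        = []
sorted-tail (_ ∷ rest) = rest

sorted-head< : ∀ {y ys} → Sorted (y ∷ ys) → All (y <_) ys
sorted-head< [-]          = []
sorted-head< (y<z ∷ rest) = Linked⇒All <-trans y<z rest

removeᵇ-∷ʳ : ∀ {x} xs → x ∉ xs → removeᵇ x (xs ∷ʳ x) ≡ xs
removeᵇ-∷ʳ {x} [] _ rewrite ≡ᵇ-refl x = refl
removeᵇ-∷ʳ {x} (y ∷ ys) x∉ rewrite ≢⇒≡ᵇ-false (x∉ ∘ here) =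
  cong (y ∷_) (removeᵇ-∷ʳ ys (x∉ ∘ there))

removeᵇ-last : ∀ {x} xs → Sorted xs → All (_≤ x) xs → x ∈ xs → removeᵇ x xs ∷ʳ x ≡ xs
removeᵇ-last {x} (y ∷ ys) sorted (_ ∷ ys≤x) x∈xs with x ≡ᵇ y in x≡ᵇy
removeᵇ-last (y ∷ []) _ _ _ | true = cong [_] (≡ᵇ-true⇒≡ x≡ᵇy)
removeᵇ-last (y ∷ z ∷ _) sorted (_ ∷ z≤x ∷ _) _ | true =
  contradiction (subst (_< z) (sym (≡ᵇ-true⇒≡ x≡ᵇy)) (All.head (sorted-head< sorted))) (≤⇒≯ z≤x)
removeᵇ-last (y ∷ ys) sorted (_ ∷ ys≤x) (here x≡y) | false = contradiction x≡y (≡ᵇ-false⇒≢ x≡ᵇy)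
removeᵇ-last (y ∷ ys) sorted (_ ∷ ys≤x) (there x∈ys) | false =
  cong (y ∷_) (removeᵇ-last ys (sorted-tail sorted) ys≤x x∈ys)

range-suc : ∀ m k → range m (suc k) ≡ range m k ∷ʳ (m + suc k)
range-suc m k = trans (cong (map (λ i → m + suc i)) (sym (upTo-∷ʳ k))) (map-++ _ (upTo k) [ k ])

range-bounded : ∀ m k → All (_< m + suc k) (range m k)
range-bounded m k = All.map⁺ (All.map (λ i<k → +-monoʳ-< m (s≤s i<k)) (All.all-upTo k))

∈-range-last : ∀ lo n → lo + suc n ∈ range lo (suc n)
∈-range-last lo n = subst (lo + suc n ∈_) (sym (range-suc lo n)) (∈-∷ʳ (lo + suc n) (range lo n))

range-suc-↭ : ∀ lo n → range lo (suc n) ↭ (lo + suc n) ∷ range lo n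
range-suc-↭ lo n = ↭-trans (↭-reflexive (range-suc lo n)) (↭-sym (∷↭∷ʳ (lo + suc n) (range lo n)))

concat-↭ : ∀ {A : Set} {xss yss : List (List A)} → xss ↭ yss → concat xss ↭ concat yss
concat-↭ Perm.refl           = ↭-refl
concat-↭ (Perm.prep xs p)    = ++⁺ˡ xs (concat-↭ p)
concat-↭ (Perm.swap xs ys p) = ↭-trans (shifts xs ys) (++⁺ˡ ys (++⁺ˡ xs (concat-↭ p)))
concat-↭ (Perm.trans p q)    = ↭-trans (concat-↭ p) (concat-↭ q)

module _ {A : Set} where
  swap-head : ∀ (a b : A) xs → a ∷ b ∷ xs ↭ b ∷ a ∷ xs
  swap-head a b xs = Perm.swap a b ↭-refl

  bury : ∀ (z a b : A) xs → z ∷ a ∷ b ∷ xs ↭ a ∷ b ∷ z ∷ xs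
  bury z a b xs = ↭-trans (swap-head z a _) (Perm.prep a (swap-head z b xs))

record BlocksValid (lo n : ℕ) (blocks : List (List ℕ)) : Set where
  field
    cover  : concat blocks ↭ range lo n
    sorted : All Sorted blocks
open BlocksValid

blocks-↭ : ∀ {lo n bs bs'} → bs ↭ bs' → BlocksValid lo n bs ⇔ BlocksValid lo n bs'
blocks-↭ p = mk⇔ (transport p) (transport (↭-sym p))
  where
  transport : ∀ {lo n bs bs'} → bs ↭ bs' → BlocksValid lo n bs → BlocksValid lo n bs'
  transport p v = record { cover = ↭-trans (concat-↭ (↭-sym p)) (cover v) ; sorted = All-resp-↭ p (sorted v) }

blocks-bounded : ∀ {lo n bs} → BlocksValid lo n bs → All (All (_< lo + suc n)) bs
blocks-bounded {lo} {n} v = All.concat⁻ (All-resp-↭ (↭-sym (cover v)) (range-bounded lo n))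

blocks-max : ∀ {lo n bs} → BlocksValid lo (suc n) bs → All (All (_≤ lo + suc n)) bs
blocks-max {lo} {n} v =
  All.map (All.map (λ {x} x< → s≤s⁻¹ (subst (suc x ≤_) (+-suc lo (suc n)) x<))) (blocks-bounded v)

blocks-removeMax : ∀ {lo n bs} → BlocksValid lo (suc n) bs →
  All (λ B → lo + suc n ∈ B → removeᵇ (lo + suc n) B ∷ʳ (lo + suc n) ≡ B) bs
blocks-removeMax v = All.zipWith (λ (B-sorted , B≤) → removeᵇ-last _ B-sorted B≤) (sorted v , blocks-max v)

blocks-occurs : ∀ {lo n bs} → BlocksValid lo (suc n) bs → Any (lo + suc n ∈_) bs
blocks-occurs {lo} {n} {bs} v = ∈-concat⁻ bs (∈-resp-↭ (↭-sym (cover v)) (∈-range-last lo n))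

blocks-empty : ∀ {lo n bs} → BlocksValid lo n bs ⇔ BlocksValid lo n ([] ∷ bs)
blocks-empty = mk⇔ (λ v → record { cover = cover v ; sorted = [] ∷ sorted v })
                   (λ v → record { cover = cover v ; sorted = All.tail (sorted v) })

data AppendedTo (y : ℕ) : List (List ℕ) → List (List ℕ) → Set where
  here  : ∀ {B bs} → AppendedTo y (B ∷ bs) ((B ∷ʳ y) ∷ bs)
  there : ∀ {B bs bs'} → AppendedTo y bs bs' → AppendedTo y (B ∷ bs) (B ∷ bs')

appendedTo-++ : ∀ {y bs bs'} xs → AppendedTo y bs bs' → AppendedTo y (xs ++ bs) (xs ++ bs')
appendedTo-++ []       a = a
appendedTo-++ (_ ∷ xs) a = there (appendedTo-++ xs a)

appendedTo-concat : ∀ {y bs bs'} → AppendedTo y bs bs' → concat bs' ↭ y ∷ concat bs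
appendedTo-concat {y} (here {B} {bs}) =
  ↭-trans (↭-reflexive (++-assoc B [ y ] (concat bs))) (shift y B (concat bs))
appendedTo-concat (there {B} a) = ↭-trans (++⁺ˡ B (appendedTo-concat a)) (shift _ B _)

appendedTo-sorted : ∀ {y bs bs'} → AppendedTo y bs bs' → All (All (_< y)) bs → All Sorted bs → All Sorted bs'
appendedTo-sorted here      (B<y ∷ _) (sB ∷ sbs) = sorted-∷ʳ sB B<y ∷ sbs
appendedTo-sorted (there a) (_ ∷ bs<y) (sB ∷ sbs) = sB ∷ appendedTo-sorted a bs<y sbs

appendedTo-sorted⁻ : ∀ {y bs bs'} → AppendedTo y bs bs' → All Sorted bs' → All Sorted bs
appendedTo-sorted⁻ (here {B}) (sB ∷ sbs) = sorted-∷ʳ⁻ B sB ∷ sbs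
appendedTo-sorted⁻ (there a)  (sB ∷ sbs) = sB ∷ appendedTo-sorted⁻ a sbs

blocks-append : ∀ {lo n bs bs'} → AppendedTo (lo + suc n) bs bs' →
  BlocksValid lo n bs ⇔ BlocksValid lo (suc n) bs'
blocks-append {lo} {n} a = mk⇔
  (λ v → record
    { cover  = ↭-trans (appendedTo-concat a) (↭-trans (Perm.prep _ (cover v)) (↭-sym (range-suc-↭ lo n)))
    ; sorted = appendedTo-sorted a (blocks-bounded v) (sorted v)
    })
  (λ v → record
    { cover  = drop-∷ (↭-trans (↭-sym (appendedTo-concat a)) (↭-trans (cover v) (range-suc-↭ lo n)))
    ; sorted = appendedTo-sorted⁻ a (sorted v)
    })

-- Layouts

AllBar : List Item → Set
AllBar = All IsBar

record Segment : Set where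
  constructor segment
  field
    bars : List Item
    blue : List ℕ
    red  : List ℕ
open Segment public

record Layout : Set where
  constructor layout
  field
    segments : List Segment
    extra    : Segment
    trailer  : List Item
open Layout public

flattenSegments : List Segment → List Item
flattenSegments []       = []
flattenSegments (s ∷ ss) = bars s ++ opair (blue s) (red s) ∷ flattenSegments ss

flatten : Layout → List Item
flatten (layout ss x t) = flattenSegments ss ++ bars x ++ xpair (blue x) (red x) ∷ t

-- The extra segment is listed first, so that the moves performed by φ never displace it.
allSegments : Layout → List Segment
allSegments L = extra L ∷ segments L

prepend : List Segment → Layout → Layout
prepend xs L = record L { segments = xs ++ segments L }

WellFormed : Layout → Set
WellFormed L = All (AllBar ∘ bars) (allSegments L) × AllBar (trailer L)

flattenSegments-++ : ∀ xs ys → flattenSegments (xs ++ ys) ≡ flattenSegments xs ++ flattenSegments ys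
flattenSegments-++ []       ys = refl
flattenSegments-++ (s ∷ xs) ys =
  trans (cong (λ z → bars s ++ _ ∷ z) (flattenSegments-++ xs ys)) (sym (++-assoc (bars s) _ _))

flatten-prepend : ∀ xs L → flatten (prepend xs L) ≡ flattenSegments xs ++ flatten L
flatten-prepend xs (layout ss x t) =
  trans (cong (_++ _) (flattenSegments-++ xs ss)) (++-assoc (flattenSegments xs) _ _)

flatten-split : ∀ ss1 si L →
  flatten (prepend ss1 (prepend [ si ] L)) ≡ flattenSegments ss1 ++ bars si ++ opair (blue si) (red si) ∷ flatten L
flatten-split ss1 si L =
  trans (flatten-prepend ss1 (prepend [ si ] L)) (cong (flattenSegments ss1 ++_) (++-assoc (bars si) _ _))

flatten-prepend-∷ : ∀ s ss L →
  flatten (prepend (s ∷ ss) L) ≡ bars s ++ opair (blue s) (red s) ∷ flattenSegments ss ++ flatten L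
flatten-prepend-∷ s ss L = trans (flatten-prepend (s ∷ ss) L) (++-assoc (bars s) _ _)

wellFormed-suffix : ∀ ss1 si L → WellFormed (prepend ss1 (prepend [ si ] L)) → WellFormed L
wellFormed-suffix ss1 si L (x-bars ∷ segments-bars , t-bars) =
  x-bars ∷ All.tail (All.++⁻ʳ ss1 segments-bars) , t-bars

parseAfter : List Item → List Item → Layout
parseAfter acc []              = layout [] (segment acc [] []) []
parseAfter acc (bbar i ∷ s)    = parseAfter (acc ∷ʳ bbar i) s
parseAfter acc (rbar i ∷ s)    = parseAfter (acc ∷ʳ rbar i) s
parseAfter acc (opair B R ∷ s) = prepend [ segment acc B R ] (parseAfter [] s)
parseAfter acc (xpair B R ∷ s) = layout [] (segment acc B R) s

parse : List Item → Layout
parse = parseAfter []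

parseAfter-bars : ∀ acc g rest → AllBar g → parseAfter acc (g ++ rest) ≡ parseAfter (acc ++ g) rest
parseAfter-bars acc [] rest _ = cong (λ a → parseAfter a rest) (sym (++-identityʳ acc))
parseAfter-bars acc (bbar i ∷ g) rest (_ ∷ g-bars) =
  trans (parseAfter-bars (acc ∷ʳ bbar i) g rest g-bars) (cong (λ a → parseAfter a rest) (++-assoc acc _ g))
parseAfter-bars acc (rbar i ∷ g) rest (_ ∷ g-bars) =
  trans (parseAfter-bars (acc ∷ʳ rbar i) g rest g-bars) (cong (λ a → parseAfter a rest) (++-assoc acc _ g))

parse-flatten : ∀ L → WellFormed L → parse (flatten L) ≡ L
parse-flatten (layout [] x t) (x-bars ∷ [] , _) = parseAfter-bars [] (bars x) _ x-bars
parse-flatten (layout (s ∷ ss) x t) (x-bars ∷ s-bars ∷ ss-bars , t-bars) = begin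
  parseAfter [] ((bars s ++ opair (blue s) (red s) ∷ flattenSegments ss) ++ _)
    ≡⟨ cong (parseAfter []) (++-assoc (bars s) _ _) ⟩
  parseAfter [] (bars s ++ opair (blue s) (red s) ∷ flatten (layout ss x t))
    ≡⟨ parseAfter-bars [] (bars s) _ s-bars ⟩
  prepend [ s ] (parse (flatten (layout ss x t)))
    ≡⟨ cong (prepend [ s ]) (parse-flatten (layout ss x t) (x-bars ∷ ss-bars , t-bars)) ⟩
  layout (s ∷ ss) x t ∎
  where open ≡-Reasoning

flatten-parseAfter : ∀ acc s → Shape s → AllBar acc →
  WellFormed (parseAfter acc s) × flatten (parseAfter acc s) ≡ acc ++ s
flatten-parseAfter acc (bbar i ∷ s) shape acc-bars =
  let wf , eq = flatten-parseAfter (acc ∷ʳ bbar i) s shape (All.∷ʳ⁺ acc-bars _)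
  in wf , trans eq (++-assoc acc _ s)
flatten-parseAfter acc (rbar i ∷ s) shape acc-bars =
  let wf , eq = flatten-parseAfter (acc ∷ʳ rbar i) s shape (All.∷ʳ⁺ acc-bars _)
  in wf , trans eq (++-assoc acc _ s)
flatten-parseAfter acc (opair B R ∷ s) shape acc-bars
  with parseAfter [] s | flatten-parseAfter [] s shape []
... | layout ss x t | (x-bars ∷ ss-bars , t-bars) , eq =
  (x-bars ∷ acc-bars ∷ ss-bars , t-bars) ,
  trans (++-assoc acc _ _) (cong (λ z → acc ++ opair B R ∷ z) eq)
flatten-parseAfter acc (xpair B R ∷ s) shape acc-bars = (acc-bars ∷ [] , after-bars s shape) , refl
  where
  after-bars : ∀ s → ShapeAfter s → AllBar s
  after-bars []           _     = []
  after-bars (bbar _ ∷ s) shape = _ ∷ after-bars s shape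
  after-bars (rbar _ ∷ s) shape = _ ∷ after-bars s shape

flatten-parse : ∀ s → Shape s → WellFormed (parse s) × flatten (parse s) ≡ s
flatten-parse s shape = flatten-parseAfter [] s shape []

flatten-injective : ∀ {L L'} → WellFormed L → WellFormed L' → flatten L ≡ flatten L' → L ≡ L'
flatten-injective {L} {L'} wf wf' eq = trans (sym (parse-flatten L wf)) (trans (cong parse eq) (parse-flatten L' wf'))

IgnoresBars : ∀ {ℓ} {X : Set ℓ} → (List Item → X) → Set ℓ
IgnoresBars c = ∀ {i} rest → IsBar i → c (i ∷ rest) ≡ c rest

ignoresBars-++ : ∀ {ℓ} {X : Set ℓ} {c : List Item → X} → IgnoresBars c →
  ∀ {g} rest → AllBar g → c (g ++ rest) ≡ c rest
ignoresBars-++ c-bar rest []                 = refl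
ignoresBars-++ c-bar rest (i-bar ∷ g-bars) = trans (c-bar _ i-bar) (ignoresBars-++ c-bar rest g-bars)

ignoresBars-all : ∀ {ℓ} {X : Set ℓ} {c : List Item → X} → IgnoresBars c → ∀ {t} → AllBar t → c t ≡ c []
ignoresBars-all {c = c} c-bar t-bars = trans (cong c (sym (++-identityʳ _))) (ignoresBars-++ c-bar [] t-bars)

module PairCollector {X : Set} (c : List Item → List X) (pick : List ℕ → List ℕ → X)
  (c-bar : IgnoresBars c) (c-opair : ∀ B R rest → c (opair B R ∷ rest) ≡ pick B R ∷ c rest) where

  collect-flattenSegments : ∀ ss rest → All (AllBar ∘ bars) ss →
    c (flattenSegments ss ++ rest) ≡ map (λ s → pick (blue s) (red s)) ss ++ c rest
  collect-flattenSegments []       rest _                  = refl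
  collect-flattenSegments (s ∷ ss) rest (s-bars ∷ ss-bars) = begin
    c ((bars s ++ opair (blue s) (red s) ∷ flattenSegments ss) ++ rest)
      ≡⟨ cong c (++-assoc (bars s) _ rest) ⟩
    c (bars s ++ opair (blue s) (red s) ∷ flattenSegments ss ++ rest)
      ≡⟨ ignoresBars-++ c-bar _ s-bars ⟩
    c (opair (blue s) (red s) ∷ flattenSegments ss ++ rest)
      ≡⟨ c-opair (blue s) (red s) _ ⟩
    pick (blue s) (red s) ∷ c (flattenSegments ss ++ rest)
      ≡⟨ cong (_ ∷_) (collect-flattenSegments ss rest ss-bars) ⟩
    pick (blue s) (red s) ∷ map (λ s → pick (blue s) (red s)) ss ++ c rest ∎
    where open ≡-Reasoning

  collect-flatten : ∀ L → WellFormed L →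
    c (flatten L) ≡ map (λ s → pick (blue s) (red s)) (segments L) ++ c (xpair (blue (extra L)) (red (extra L)) ∷ trailer L)
  collect-flatten (layout ss x t) (x-bars ∷ ss-bars , _) =
    trans (collect-flattenSegments ss _ ss-bars) (cong (_ ++_) (ignoresBars-++ c-bar _ x-bars))

blueBlocks-ignoresBars : IgnoresBars blueBlocks
blueBlocks-ignoresBars {bbar _} _ _ = refl
blueBlocks-ignoresBars {rbar _} _ _ = refl

redBlocks-ignoresBars : IgnoresBars redBlocks
redBlocks-ignoresBars {bbar _} _ _ = refl
redBlocks-ignoresBars {rbar _} _ _ = refl

ordBlue-ignoresBars : IgnoresBars ordBlue
ordBlue-ignoresBars {bbar _} _ _ = refl
ordBlue-ignoresBars {rbar _} _ _ = refl

ordRed-ignoresBars : IgnoresBars ordRed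
ordRed-ignoresBars {bbar _} _ _ = refl
ordRed-ignoresBars {rbar _} _ _ = refl

module BlueBlocks = PairCollector blueBlocks (λ B _ → B) blueBlocks-ignoresBars (λ _ _ _ → refl)
module RedBlocks  = PairCollector redBlocks  (λ _ R → R) redBlocks-ignoresBars  (λ _ _ _ → refl)
module OrdBlue    = PairCollector ordBlue    (λ B _ → B) ordBlue-ignoresBars    (λ _ _ _ → refl)
module OrdRed     = PairCollector ordRed     (λ _ R → R) ordRed-ignoresBars     (λ _ _ _ → refl)

blueBlocks-flatten : ∀ L → WellFormed L → blueBlocks (flatten L) ≡ map blue (segments L) ∷ʳ blue (extra L)
blueBlocks-flatten L wf@(_ , t-bars) =
  trans (BlueBlocks.collect-flatten L wf)
    (cong (λ z → map blue (segments L) ++ blue (extra L) ∷ z) (ignoresBars-all blueBlocks-ignoresBars t-bars))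

redBlocks-flatten : ∀ L → WellFormed L → redBlocks (flatten L) ≡ map red (segments L) ∷ʳ red (extra L)
redBlocks-flatten L wf@(_ , t-bars) =
  trans (RedBlocks.collect-flatten L wf)
    (cong (λ z → map red (segments L) ++ red (extra L) ∷ z) (ignoresBars-all redBlocks-ignoresBars t-bars))

ordBlue-flatten : ∀ L → WellFormed L → ordBlue (flatten L) ≡ map blue (segments L)
ordBlue-flatten L wf@(_ , t-bars) =
  trans (OrdBlue.collect-flatten L wf)
    (trans (cong (map blue (segments L) ++_) (ignoresBars-all ordBlue-ignoresBars t-bars)) (++-identityʳ _))

ordRed-flatten : ∀ L → WellFormed L → ordRed (flatten L) ≡ map red (segments L)
ordRed-flatten L wf@(_ , t-bars) =
  trans (OrdRed.collect-flatten L wf)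
    (trans (cong (map red (segments L) ++_) (ignoresBars-all ordRed-ignoresBars t-bars)) (++-identityʳ _))

IgnoresOrdinaryPairs : ∀ {ℓ} {X : Set ℓ} → (List Item → X) → Set ℓ
IgnoresOrdinaryPairs c = IgnoresBars c × (∀ B R rest → c (opair B R ∷ rest) ≡ c rest)

ignoresOrdinaryPairs-flatten : ∀ {ℓ} {X : Set ℓ} {c : List Item → X} → IgnoresOrdinaryPairs c →
  ∀ L → WellFormed L → c (flatten L) ≡ c (xpair (blue (extra L)) (red (extra L)) ∷ trailer L)
ignoresOrdinaryPairs-flatten {c = c} (c-bar , c-opair) (layout ss x t) (x-bars ∷ ss-bars , _) =
  trans (skipSegments ss ss-bars) (ignoresBars-++ c-bar _ x-bars)
  where
  skipSegments : ∀ ss {rest} → All (AllBar ∘ bars) ss → c (flattenSegments ss ++ rest) ≡ c rest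
  skipSegments []       _                  = refl
  skipSegments (s ∷ ss) (s-bars ∷ ss-bars) =
    trans (cong c (++-assoc (bars s) _ _))
      (trans (ignoresBars-++ c-bar _ s-bars) (trans (c-opair _ _ _) (skipSegments ss ss-bars)))

xRed-ignoresOrdinaryPairs : IgnoresOrdinaryPairs xRed
xRed-ignoresOrdinaryPairs = (λ { {bbar _} _ _ → refl ; {rbar _} _ _ → refl }) , (λ _ _ _ → refl)

shape-ignoresOrdinaryPairs : IgnoresOrdinaryPairs Shape
shape-ignoresOrdinaryPairs = (λ { {bbar _} _ _ → refl ; {rbar _} _ _ → refl }) , (λ _ _ _ → refl)

xRed-flatten : ∀ L → WellFormed L → xRed (flatten L) ≡ red (extra L)
xRed-flatten = ignoresOrdinaryPairs-flatten xRed-ignoresOrdinaryPairs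

shape-flatten : ∀ L → WellFormed L → Shape (flatten L)
shape-flatten L wf@(_ , t-bars) =
  subst (λ A → A) (sym (ignoresOrdinaryPairs-flatten shape-ignoresOrdinaryPairs L wf)) (shapeAfter t-bars)
  where
  shapeAfter : ∀ {t} → AllBar t → ShapeAfter t
  shapeAfter {[]}         _              = _
  shapeAfter {bbar _ ∷ _} (_ ∷ t-bars) = shapeAfter t-bars
  shapeAfter {rbar _ ∷ _} (_ ∷ t-bars) = shapeAfter t-bars

bbarLabels-++ : ∀ xs ys → bbarLabels (xs ++ ys) ≡ bbarLabels xs ++ bbarLabels ys
bbarLabels-++ []              ys = refl
bbarLabels-++ (bbar i ∷ xs)    ys = cong (i ∷_) (bbarLabels-++ xs ys)
bbarLabels-++ (rbar _ ∷ xs)    ys = bbarLabels-++ xs ys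
bbarLabels-++ (opair _ _ ∷ xs) ys = bbarLabels-++ xs ys
bbarLabels-++ (xpair _ _ ∷ xs) ys = bbarLabels-++ xs ys

rbarLabels-++ : ∀ xs ys → rbarLabels (xs ++ ys) ≡ rbarLabels xs ++ rbarLabels ys
rbarLabels-++ []              ys = refl
rbarLabels-++ (bbar _ ∷ xs)    ys = rbarLabels-++ xs ys
rbarLabels-++ (rbar i ∷ xs)    ys = cong (i ∷_) (rbarLabels-++ xs ys)
rbarLabels-++ (opair _ _ ∷ xs) ys = rbarLabels-++ xs ys
rbarLabels-++ (xpair _ _ ∷ xs) ys = rbarLabels-++ xs ys

module BarCollector (c : List Item → List ℕ) (c-++ : ∀ xs ys → c (xs ++ ys) ≡ c xs ++ c ys)
  (c-opair : ∀ B R rest → c (opair B R ∷ rest) ≡ c rest)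
  (c-xpair : ∀ B R rest → c (xpair B R ∷ rest) ≡ c rest) where

  collect-flattenSegments : ∀ ss rest → c (flattenSegments ss ++ rest) ≡ concatMap c (map bars ss) ++ c rest
  collect-flattenSegments []       rest = refl
  collect-flattenSegments (s ∷ ss) rest = begin
    c ((bars s ++ opair (blue s) (red s) ∷ flattenSegments ss) ++ rest)
      ≡⟨ cong c (++-assoc (bars s) _ rest) ⟩
    c (bars s ++ opair (blue s) (red s) ∷ flattenSegments ss ++ rest)
      ≡⟨ c-++ (bars s) _ ⟩
    c (bars s) ++ c (opair (blue s) (red s) ∷ flattenSegments ss ++ rest)
      ≡⟨ cong (c (bars s) ++_) (trans (c-opair _ _ _) (collect-flattenSegments ss rest)) ⟩
    c (bars s) ++ concatMap c (map bars ss) ++ c rest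
      ≡⟨ ++-assoc (c (bars s)) _ _ ⟨
    concatMap c (map bars (s ∷ ss)) ++ c rest ∎
    where open ≡-Reasoning

  collect-flatten : ∀ L → c (flatten L) ↭ concatMap c (map bars (allSegments L)) ++ c (trailer L)
  collect-flatten (layout ss x t) = begin
    c (flattenSegments ss ++ bars x ++ xpair (blue x) (red x) ∷ t)
      ≡⟨ collect-flattenSegments ss _ ⟩
    concatMap c (map bars ss) ++ c (bars x ++ xpair (blue x) (red x) ∷ t)
      ≡⟨ cong (concatMap c (map bars ss) ++_) (trans (c-++ (bars x) _) (cong (c (bars x) ++_) (c-xpair _ _ t))) ⟩
    concatMap c (map bars ss) ++ c (bars x) ++ c t
      ↭⟨ shifts (concatMap c (map bars ss)) (c (bars x)) ⟩
    c (bars x) ++ concatMap c (map bars ss) ++ c t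
      ≡⟨ ++-assoc (c (bars x)) _ _ ⟨
    concatMap c (map bars (x ∷ ss)) ++ c t ∎
    where open PermutationReasoning

module BlueLabels = BarCollector bbarLabels bbarLabels-++ (λ _ _ _ → refl) (λ _ _ _ → refl)
module RedLabels  = BarCollector rbarLabels rbarLabels-++ (λ _ _ _ → refl) (λ _ _ _ → refl)

IsPair : Item → Set
IsPair (opair _ _) = ⊤
IsPair (xpair _ _) = ⊤
IsPair (bbar _)    = ⊥
IsPair (rbar _)    = ⊥

-- BarsOK asks of the last bar of a group only that a pair follows, not which one.
GroupOK : List Item → Set
GroupOK g = BarsOK (g ++ [ opair [] [] ])

blueNext-pair : ∀ {i} g {p q rest rest'} → IsPair p → IsPair q →
  BlueNext i (g ++ p ∷ rest) → BlueNext i (g ++ q ∷ rest')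
blueNext-pair []              {opair _ _} _ _ ()
blueNext-pair []              {xpair _ _} _ _ ()
blueNext-pair (bbar _ ∷ _)    _ _ next = next
blueNext-pair (rbar _ ∷ _)    _ _ next = next

redNext-pair : ∀ {i} g {p q rest rest'} → IsPair p → IsPair q →
  RedNext i (g ++ p ∷ rest) → RedNext i (g ++ q ∷ rest')
redNext-pair []              {q = opair _ _} _ _ _ = _
redNext-pair []              {q = xpair _ _} _ _ _ = _
redNext-pair (bbar _ ∷ _)    _ _ next = next
redNext-pair (rbar _ ∷ _)    _ _ next = next
redNext-pair (opair _ _ ∷ _) _ _ next = next
redNext-pair (xpair _ _ ∷ _) _ _ next = next

barsOK-pair : ∀ {p rest} → IsPair p → BarsOK (p ∷ rest) ≡ BarsOK rest
barsOK-pair {opair _ _} _ = refl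
barsOK-pair {xpair _ _} _ = refl

barsOK-split : ∀ g {p rest} → IsPair p → BarsOK (g ++ p ∷ rest) → GroupOK g × BarsOK rest
barsOK-split []              p ok = _ , subst (λ A → A) (barsOK-pair p) ok
barsOK-split (bbar _ ∷ g)    p (next , ok) =
  let g-ok , rest-ok = barsOK-split g p ok in (blueNext-pair g p _ next , g-ok) , rest-ok
barsOK-split (rbar _ ∷ g)    p (next , ok) =
  let g-ok , rest-ok = barsOK-split g p ok in (redNext-pair g p _ next , g-ok) , rest-ok
barsOK-split (opair _ _ ∷ g) p ok = barsOK-split g p ok
barsOK-split (xpair _ _ ∷ g) p ok = barsOK-split g p ok

barsOK-join : ∀ g {p rest} → IsPair p → GroupOK g → BarsOK rest → BarsOK (g ++ p ∷ rest)
barsOK-join []              p _ rest-ok = subst (λ A → A) (sym (barsOK-pair p)) rest-ok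
barsOK-join (bbar _ ∷ g)    p (next , g-ok) rest-ok = blueNext-pair g _ p next , barsOK-join g p g-ok rest-ok
barsOK-join (rbar _ ∷ g)    p (next , g-ok) rest-ok = redNext-pair g _ p next , barsOK-join g p g-ok rest-ok
barsOK-join (opair _ _ ∷ g) p g-ok rest-ok = barsOK-join g p g-ok rest-ok
barsOK-join (xpair _ _ ∷ g) p g-ok rest-ok = barsOK-join g p g-ok rest-ok

barsOK-flatten⁻ : ∀ L → BarsOK (flatten L) → All GroupOK (map bars (allSegments L)) × BarsOK (trailer L)
barsOK-flatten⁻ (layout [] x t) ok = let x-ok , t-ok = barsOK-split (bars x) _ ok in x-ok ∷ [] , t-ok
barsOK-flatten⁻ (layout (s ∷ ss) x t) ok =
  let s-ok , rest-ok = barsOK-split (bars s) _ (subst BarsOK (++-assoc (bars s) _ _) ok)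
      xss-ok , t-ok  = barsOK-flatten⁻ (layout ss x t) rest-ok
  in All.head xss-ok ∷ s-ok ∷ All.tail xss-ok , t-ok

barsOK-flatten⁺ : ∀ L → All GroupOK (map bars (allSegments L)) → BarsOK (trailer L) → BarsOK (flatten L)
barsOK-flatten⁺ (layout [] x t) (x-ok ∷ []) t-ok = barsOK-join (bars x) _ x-ok t-ok
barsOK-flatten⁺ (layout (s ∷ ss) x t) (x-ok ∷ s-ok ∷ ss-ok) t-ok =
  subst BarsOK (sym (++-assoc (bars s) _ _))
    (barsOK-join (bars s) _ s-ok (barsOK-flatten⁺ (layout ss x t) (x-ok ∷ ss-ok) t-ok))

record BarsValid (m : ℕ) (groups : List (List Item)) (t : List Item) : Set where
  field
    groupBars   : All AllBar groups
    trailerBars : AllBar t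
    blueLabels  : concatMap bbarLabels groups ++ bbarLabels t ↭ map suc (upTo m)
    redLabels   : concatMap rbarLabels groups ++ rbarLabels t ↭ upTo (suc m)
    groupsOK    : All GroupOK groups
    trailerOK   : BarsOK t
open BarsValid

bars-↭ : ∀ {m gs gs' t} → gs ↭ gs' → BarsValid m gs t ⇔ BarsValid m gs' t
bars-↭ p = mk⇔ (transport p) (transport (↭-sym p))
  where
  transport : ∀ {m gs gs' t} → gs ↭ gs' → BarsValid m gs t → BarsValid m gs' t
  transport {m} {gs} {gs'} {t} p v = record
    { groupBars   = All-resp-↭ p (groupBars v)
    ; trailerBars = trailerBars v
    ; blueLabels  = relabel bbarLabels (blueLabels v)
    ; redLabels   = relabel rbarLabels (redLabels v)
    ; groupsOK    = All-resp-↭ p (groupsOK v)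
    ; trailerOK   = trailerOK v
    }
    where
    relabel : ∀ {ys} (c : List Item → List ℕ) → concatMap c gs ++ c t ↭ ys → concatMap c gs' ++ c t ↭ ys
    relabel c labels = ↭-trans (++⁺ʳ (c t) (concat-↭ (map⁺ c (↭-sym p)))) labels

bars-empty : ∀ {m gs t} → BarsValid m gs t ⇔ BarsValid m ([] ∷ gs) t
bars-empty = mk⇔
  (λ v → record
    { groupBars = [] ∷ groupBars v ; trailerBars = trailerBars v
    ; blueLabels = blueLabels v ; redLabels = redLabels v
    ; groupsOK = _ ∷ groupsOK v ; trailerOK = trailerOK v
    })
  (λ v → record
    { groupBars = All.tail (groupBars v) ; trailerBars = trailerBars v
    ; blueLabels = blueLabels v ; redLabels = redLabels v
    ; groupsOK = All.tail (groupsOK v) ; trailerOK = trailerOK v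
    })

-- Valid layouts

ValidBars : ℕ → Layout → Set
ValidBars m L = BarsValid m (map bars (allSegments L)) (trailer L)

ValidBlues ValidReds : ℕ → ℕ → Layout → Set
ValidBlues m k L = BlocksValid m k (map blue (allSegments L))
ValidReds  m n L = BlocksValid m n (map red (allSegments L))

record Valid (m k n : ℕ) (L : Layout) : Set where
  field
    barsValid    : ValidBars m L
    bluesValid   : ValidBlues m k L
    redsValid    : ValidReds m n L
    blueNonEmpty : All (NonEmpty ∘ blue) (segments L)
    redNonEmpty  : All (NonEmpty ∘ red) (segments L)
open Valid

valid-wellFormed : ∀ {m k n L} → Valid m k n L → WellFormed L
valid-wellFormed v = All.map⁻ (groupBars (barsValid v)) , trailerBars (barsValid v)

extraLast-↭ : ∀ {X : Set} (f : Segment → X) L → map f (segments L) ∷ʳ f (extra L) ↭ map f (allSegments L)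
extraLast-↭ f L = ↭-sym (∷↭∷ʳ (f (extra L)) (map f (segments L)))

C⇒valid : ∀ {m k n} L → WellFormed L → C m k n (flatten L) → Valid m k n L
C⇒valid L wf@(groups-bars , t-bars) c = record
  { barsValid = record
    { groupBars   = All.map⁺ groups-bars
    ; trailerBars = t-bars
    ; blueLabels  = ↭-trans (↭-sym (BlueLabels.collect-flatten L)) (C.blueBarsOK c)
    ; redLabels   = ↭-trans (↭-sym (RedLabels.collect-flatten L)) (C.redBarsOK c)
    ; groupsOK    = proj₁ (barsOK-flatten⁻ L (C.barsOK c))
    ; trailerOK   = proj₂ (barsOK-flatten⁻ L (C.barsOK c))
    }
  ; bluesValid = to (blocks-↭ (extraLast-↭ blue L))
      (subst (BlocksValid _ _) (blueBlocks-flatten L wf) (record { cover = C.blueCover c ; sorted = C.blueSorted c }))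
  ; redsValid = to (blocks-↭ (extraLast-↭ red L))
      (subst (BlocksValid _ _) (redBlocks-flatten L wf) (record { cover = C.redCover c ; sorted = C.redSorted c }))
  ; blueNonEmpty = All.map⁻ (subst (All NonEmpty) (ordBlue-flatten L wf) (C.blueNonEmpty c))
  ; redNonEmpty  = All.map⁻ (subst (All NonEmpty) (ordRed-flatten L wf) (C.redNonEmpty c))
  }

valid⇒C : ∀ {m k n} L → Valid m k n L → C m k n (flatten L)
valid⇒C L v = record
  { shape        = shape-flatten L wf
  ; blueBarsOK   = ↭-trans (BlueLabels.collect-flatten L) (blueLabels (barsValid v))
  ; redBarsOK    = ↭-trans (RedLabels.collect-flatten L) (redLabels (barsValid v))
  ; barsOK       = barsOK-flatten⁺ L (groupsOK (barsValid v)) (trailerOK (barsValid v))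
  ; blueCover    = cover blocks-blue
  ; redCover     = cover blocks-red
  ; blueSorted   = sorted blocks-blue
  ; redSorted    = sorted blocks-red
  ; blueNonEmpty = subst (All NonEmpty) (sym (ordBlue-flatten L wf)) (All.map⁺ (blueNonEmpty v))
  ; redNonEmpty  = subst (All NonEmpty) (sym (ordRed-flatten L wf)) (All.map⁺ (redNonEmpty v))
  }
  where
  wf = valid-wellFormed v
  blocks-blue : BlocksValid _ _ (blueBlocks (flatten L))
  blocks-blue = subst (BlocksValid _ _) (sym (blueBlocks-flatten L wf)) (from (blocks-↭ (extraLast-↭ blue L)) (bluesValid v))
  blocks-red : BlocksValid _ _ (redBlocks (flatten L))
  blocks-red = subst (BlocksValid _ _) (sym (redBlocks-flatten L wf)) (from (blocks-↭ (extraLast-↭ red L)) (redsValid v))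

blueBounds : ∀ {m k n} L → Valid m k n L → All (λ s → All (_< m + suc k) (blue s)) (allSegments L)
blueBounds L v = All.map⁻ (blocks-bounded (bluesValid v))

redBounds : ∀ {m k n} L → Valid m k n L → All (λ s → All (_< m + suc n) (red s)) (allSegments L)
redBounds L v = All.map⁻ (blocks-bounded (redsValid v))

blueMax : ∀ {m k n} L → Valid m (suc k) n L →
  All (λ s → m + suc k ∈ blue s → removeᵇ (m + suc k) (blue s) ∷ʳ (m + suc k) ≡ blue s) (allSegments L)
blueMax L v = All.map⁻ (blocks-removeMax (bluesValid v))

redMax : ∀ {m k n} L → Valid m k (suc n) L →
  All (λ s → m + suc n ∈ red s → removeᵇ (m + suc n) (red s) ∷ʳ (m + suc n) ≡ red s) (allSegments L)
redMax L v = All.map⁻ (blocks-removeMax (redsValid v))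

fresh⇒elemᵇ : ∀ {f : Segment → List ℕ} {y ss} →
  All (λ s → All (_< y) (f s)) ss → All (λ s → elemᵇ y (f s) ≡ false) ss
fresh⇒elemᵇ = All.map (∉⇒¬elemᵇ ∘ ∉-bounded)

FirstOccurrence : (Segment → List ℕ) → ℕ → List Segment → Set
FirstOccurrence f y ss = Σ (List Segment) λ ss1 → Σ Segment λ si → Σ (List Segment) λ ss2 →
  ss ≡ ss1 ++ si ∷ ss2 × All (λ s → elemᵇ y (f s) ≡ false) ss1 × elemᵇ y (f si) ≡ true

firstOccurrence : ∀ f y ss → All (λ s → elemᵇ y (f s) ≡ false) ss ⊎ FirstOccurrence f y ss
firstOccurrence f y []       = inj₁ []
firstOccurrence f y (s ∷ ss) with elemᵇ y (f s) in y∈?s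
... | true  = inj₂ ([] , s , ss , refl , [] , y∈?s)
... | false with firstOccurrence f y ss
...   | inj₁ none = inj₁ (y∈?s ∷ none)
...   | inj₂ (ss1 , si , ss2 , eq , y∉ss1 , y∈si) =
  inj₂ (s ∷ ss1 , si , ss2 , cong (s ∷_) eq , y∈?s ∷ y∉ss1 , y∈si)

all¬elemᵇ⇒¬Any : ∀ {f : Segment → List ℕ} {y ss} → All (λ s → elemᵇ y (f s) ≡ false) ss → ¬ Any (λ s → y ∈ f s) ss
all¬elemᵇ⇒¬Any (y∉s ∷ _)  (here y∈s)   = ¬elemᵇ⇒∉ y∉s y∈s
all¬elemᵇ⇒¬Any (_ ∷ y∉ss) (there y∈ss) = all¬elemᵇ⇒¬Any y∉ss y∈ss

setExtraRed : List ℕ → Layout → Layout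
setExtraRed R L = record L { extra = record (extra L) { red = R } }

clearRed : Layout → Layout
clearRed = setExtraRed []

addHeadBlue : ℕ → Layout → Layout
addHeadBlue y (layout []       x t) = layout [] (record x { blue = blue x ∷ʳ y }) t
addHeadBlue y (layout (s ∷ ss) x t) = layout (record s { blue = blue s ∷ʳ y } ∷ ss) x t

removeHeadBlue : ℕ → Layout → Layout
removeHeadBlue y (layout []       x t) = layout [] (record x { blue = removeᵇ y (blue x) }) t
removeHeadBlue y (layout (s ∷ ss) x t) = layout (record s { blue = removeᵇ y (blue s) } ∷ ss) x t

addHeadBlue-wellFormed : ∀ y L → WellFormed L → WellFormed (addHeadBlue y L)
addHeadBlue-wellFormed y (layout []       x t) (x-bars ∷ [] , t-bars)       = x-bars ∷ [] , t-bars
addHeadBlue-wellFormed y (layout (s ∷ ss) x t) (x-bars ∷ s-bars ∷ ss-bars , t-bars) = x-bars ∷ s-bars ∷ ss-bars , t-bars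

module _ {X : Set} (f : Segment → X) where
  map-shift : ∀ ss1 s ss2 → map f (ss1 ++ s ∷ ss2) ↭ f s ∷ map f (ss1 ++ ss2)
  map-shift ss1 s ss2 = begin
    map f (ss1 ++ s ∷ ss2)         ≡⟨ map-++ f ss1 (s ∷ ss2) ⟩
    map f ss1 ++ f s ∷ map f ss2   ↭⟨ shift (f s) (map f ss1) (map f ss2) ⟩
    f s ∷ map f ss1 ++ map f ss2   ≡⟨ cong (f s ∷_) (map-++ f ss1 ss2) ⟨
    f s ∷ map f (ss1 ++ ss2)       ∎
    where open PermutationReasoning

  split-↭ : ∀ ss1 si L → map f (allSegments (prepend ss1 (prepend [ si ] L))) ↭
    f (extra L) ∷ f si ∷ map f (ss1 ++ segments L)
  split-↭ ss1 si L = Perm.prep (f (extra L)) (map-shift ss1 si (segments L))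

addHeadBlue-appendedTo : ∀ y P L →
  AppendedTo y (map blue (allSegments (prepend P L))) (map blue (allSegments (prepend P (addHeadBlue y L))))
addHeadBlue-appendedTo y P (layout []       x t) = here
addHeadBlue-appendedTo y P (layout (s ∷ ss) x t) =
  there (subst₂ (AppendedTo y) (sym (map-++ blue P _)) (sym (map-++ blue P _)) (appendedTo-++ (map blue P) here))

≡⇒⇔ : ∀ {A B : Set} → A ≡ B → A ⇔ B
≡⇒⇔ refl = mk⇔ (λ a → a) (λ a → a)

addHeadBlue-bars : ∀ {m} y P L → ValidBars m (prepend P L) ⇔ ValidBars m (prepend P (clearRed (addHeadBlue y L)))
addHeadBlue-bars y P (layout []       x t) = ≡⇒⇔ refl
addHeadBlue-bars {m} y P (layout (s ∷ ss) x t) =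
  ≡⇒⇔ (cong (λ gs → BarsValid m (bars x ∷ gs) t) (trans (map-++ bars P (s ∷ ss)) (sym (map-++ bars P _))))

addHeadBlue-blues : ∀ {lo k} P L →
  ValidBlues lo k (prepend P L) ⇔ ValidBlues lo (suc k) (prepend P (clearRed (addHeadBlue (lo + suc k) L)))
addHeadBlue-blues P L = blocks-append (addHeadBlue-appendedTo _ P L)

addHeadBlue-reds : ∀ y P L →
  map red (allSegments (prepend P (clearRed (addHeadBlue y L)))) ≡ map red (allSegments (prepend P (clearRed L)))
addHeadBlue-reds y P (layout []       x t) = refl
addHeadBlue-reds y P (layout (s ∷ ss) x t) = cong ([] ∷_) (trans (map-++ red P _) (sym (map-++ red P (s ∷ ss))))

addHeadBlue-redAll : ∀ {P : List ℕ → Set} y L →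
  All (P ∘ red) (segments L) ⇔ All (P ∘ red) (segments (addHeadBlue y L))
addHeadBlue-redAll y (layout []       x t) = mk⇔ (λ ps → ps) (λ ps → ps)
addHeadBlue-redAll y (layout (s ∷ ss) x t) = mk⇔ (λ { (p ∷ ps) → p ∷ ps }) (λ { (p ∷ ps) → p ∷ ps })

addHeadBlue-blueNonEmpty : ∀ y L →
  All (NonEmpty ∘ blue) (segments L) → All (NonEmpty ∘ blue) (segments (addHeadBlue y L))
addHeadBlue-blueNonEmpty y (layout []       x t) []       = []
addHeadBlue-blueNonEmpty y (layout (s ∷ ss) x t) (_ ∷ ne) = ∷ʳ-nonEmpty (blue s) ∷ ne

clearX-++ : ∀ xs ys → clearX (xs ++ ys) ≡ clearX xs ++ clearX ys
clearX-++ []              ys = refl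
clearX-++ (bbar _ ∷ xs)    ys = cong (_ ∷_) (clearX-++ xs ys)
clearX-++ (rbar _ ∷ xs)    ys = cong (_ ∷_) (clearX-++ xs ys)
clearX-++ (opair _ _ ∷ xs) ys = cong (_ ∷_) (clearX-++ xs ys)
clearX-++ (xpair _ _ ∷ xs) ys = cong (_ ∷_) (clearX-++ xs ys)

clearX-bars : ∀ {g} → AllBar g → clearX g ≡ g
clearX-bars {[]}         _              = refl
clearX-bars {bbar _ ∷ _} (_ ∷ g-bars) = cong (_ ∷_) (clearX-bars g-bars)
clearX-bars {rbar _ ∷ _} (_ ∷ g-bars) = cong (_ ∷_) (clearX-bars g-bars)

clearX-flattenSegments : ∀ ss → All (AllBar ∘ bars) ss → clearX (flattenSegments ss) ≡ flattenSegments ss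
clearX-flattenSegments []       _                  = refl
clearX-flattenSegments (s ∷ ss) (s-bars ∷ ss-bars) =
  trans (clearX-++ (bars s) _) (cong₂ _++_ (clearX-bars s-bars) (cong (_ ∷_) (clearX-flattenSegments ss ss-bars)))

clearX-flatten : ∀ L → WellFormed L → clearX (flatten L) ≡ flatten (clearRed L)
clearX-flatten (layout ss x t) (x-bars ∷ ss-bars , t-bars) =
  trans (clearX-++ (flattenSegments ss) _)
    (cong₂ _++_ (clearX-flattenSegments ss ss-bars)
      (trans (clearX-++ (bars x) _) (cong₂ _++_ (clearX-bars x-bars) (cong (_ ∷_) (clearX-bars t-bars)))))

addFirst-bars : ∀ y {g} rest → AllBar g → addFirst y (g ++ rest) ≡ g ++ addFirst y rest
addFirst-bars y {[]}         rest _              = refl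
addFirst-bars y {bbar _ ∷ _} rest (_ ∷ g-bars) = cong (_ ∷_) (addFirst-bars y rest g-bars)
addFirst-bars y {rbar _ ∷ _} rest (_ ∷ g-bars) = cong (_ ∷_) (addFirst-bars y rest g-bars)

addFirst-flatten : ∀ y L → WellFormed L → addFirst y (flatten L) ≡ flatten (addHeadBlue y L)
addFirst-flatten y (layout [] x t) (x-bars ∷ _ , _) = addFirst-bars y _ x-bars
addFirst-flatten y (layout (s ∷ ss) x t) (_ ∷ s-bars ∷ _ , _) =
  trans (cong (addFirst y) (++-assoc (bars s) _ _))
    (trans (addFirst-bars y _ s-bars) (sym (++-assoc (bars s) _ _)))

phi-A1 : ∀ m k n L → WellFormed L →
  elemᵇ (m + n) (red (extra L)) ≡ true → null (removeᵇ (m + n) (red (extra L))) ≡ true →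
  phi m k n (flatten L) ≡ flatten (clearRed (addHeadBlue (m + suc k) L))
phi-A1 m k n L wf mn∈R R'-null rewrite xRed-flatten L wf | mn∈R | R'-null =
  trans (cong clearX (addFirst-flatten (m + suc k) L wf))
    (clearX-flatten (addHeadBlue (m + suc k) L) (addHeadBlue-wellFormed (m + suc k) L wf))

phi-A2 : ∀ m k n L → WellFormed L →
  elemᵇ (m + n) (red (extra L)) ≡ true → null (removeᵇ (m + n) (red (extra L))) ≡ false →
  phi m k n (flatten L) ≡
  flatten (prepend [ segment [] [ m + suc k ] (removeᵇ (m + n) (red (extra L))) ] (clearRed L))
phi-A2 m k n L wf mn∈R R'-nonnull rewrite xRed-flatten L wf | mn∈R | R'-nonnull =
  cong (opair [ m + suc k ] (removeᵇ (m + n) (red (extra L))) ∷_) (clearX-flatten L wf)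

findPair-bars : ∀ x {g} rest {p b r q} → AllBar g → findPair x rest ≡ mkSplit p b r q →
  findPair x (g ++ rest) ≡ mkSplit (g ++ p) b r q
findPair-bars x {[]}         rest _              found = found
findPair-bars x {bbar _ ∷ _} rest (_ ∷ g-bars) found rewrite findPair-bars x rest g-bars found = refl
findPair-bars x {rbar _ ∷ _} rest (_ ∷ g-bars) found rewrite findPair-bars x rest g-bars found = refl

findPair-flattenSegments : ∀ x ss1 si post → All (AllBar ∘ bars) (si ∷ ss1) →
  All (λ s → elemᵇ x (red s) ≡ false) ss1 → elemᵇ x (red si) ≡ true →
  findPair x (flattenSegments ss1 ++ bars si ++ opair (blue si) (red si) ∷ post) ≡
  mkSplit (flattenSegments ss1 ++ bars si) (blue si) (red si) post
findPair-flattenSegments x [] si post (si-bars ∷ []) [] x∈Ri =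
  trans (findPair-bars x _ si-bars found) (cong (λ p → mkSplit p (blue si) (red si) post) (++-identityʳ (bars si)))
  where
  found : findPair x (opair (blue si) (red si) ∷ post) ≡ mkSplit [] (blue si) (red si) post
  found rewrite x∈Ri = refl
findPair-flattenSegments x (s ∷ ss1) si post (si-bars ∷ s-bars ∷ ss1-bars) (x∉Rs ∷ x∉ss1) x∈Ri = begin
  findPair x ((bars s ++ opair (blue s) (red s) ∷ flattenSegments ss1) ++ rest)
    ≡⟨ cong (findPair x) (++-assoc (bars s) _ rest) ⟩
  findPair x (bars s ++ opair (blue s) (red s) ∷ flattenSegments ss1 ++ rest)
    ≡⟨ findPair-bars x _ s-bars (skip (findPair-flattenSegments x ss1 si post (si-bars ∷ ss1-bars) x∉ss1 x∈Ri)) ⟩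
  mkSplit (bars s ++ opair (blue s) (red s) ∷ flattenSegments ss1 ++ bars si) (blue si) (red si) post
    ≡⟨ cong (λ p → mkSplit p (blue si) (red si) post) (++-assoc (bars s) _ _) ⟨
  mkSplit (flattenSegments (s ∷ ss1) ++ bars si) (blue si) (red si) post ∎
  where
  open ≡-Reasoning
  rest = bars si ++ opair (blue si) (red si) ∷ post
  skip : ∀ {p} → findPair x (flattenSegments ss1 ++ rest) ≡ mkSplit p (blue si) (red si) post →
    findPair x (opair (blue s) (red s) ∷ flattenSegments ss1 ++ rest) ≡
    mkSplit (opair (blue s) (red s) ∷ p) (blue si) (red si) post
  skip found rewrite x∉Rs | found = refl

takeWhileRev-bars : ∀ {bs} ys → AllBar bs → takeWhileRev ys ≡ ([] , ys) → takeWhileRev (bs ++ ys) ≡ (reverse bs , ys)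
takeWhileRev-bars                ys []               stop = stop
takeWhileRev-bars {bbar i ∷ bs} ys (_ ∷ bs-bars) stop
  rewrite takeWhileRev-bars ys bs-bars stop | unfold-reverse (bbar i) bs = refl
takeWhileRev-bars {rbar i ∷ bs} ys (_ ∷ bs-bars) stop
  rewrite takeWhileRev-bars ys bs-bars stop | unfold-reverse (rbar i) bs = refl

flattenSegments-last : ∀ ss → flattenSegments ss ≡ [] ⊎ ∃₂ λ ys p → IsPair p × flattenSegments ss ≡ ys ∷ʳ p
flattenSegments-last []       = inj₁ refl
flattenSegments-last (s ∷ ss) with flattenSegments-last ss
... | inj₁ empty = inj₂ (bars s , _ , _ , cong (λ z → bars s ++ _ ∷ z) empty)
... | inj₂ (ys , p , pair , eq) =
  inj₂ (bars s ++ _ ∷ ys , p , pair , trans (cong (λ z → bars s ++ _ ∷ z) eq) (sym (++-assoc (bars s) _ [ p ])))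

takeWhileRev-flattenSegments : ∀ ss →
  takeWhileRev (reverse (flattenSegments ss)) ≡ ([] , reverse (flattenSegments ss))
takeWhileRev-flattenSegments ss with flattenSegments-last ss
... | inj₁ empty = subst (λ z → takeWhileRev (reverse z) ≡ ([] , reverse z)) (sym empty) refl
... | inj₂ (ys , p , pair , eq) =
  subst (λ z → takeWhileRev (reverse z) ≡ ([] , reverse z)) (sym eq) (stop p pair)
  where
  stop : ∀ p → IsPair p → takeWhileRev (reverse (ys ∷ʳ p)) ≡ ([] , reverse (ys ∷ʳ p))
  stop (opair B R) _ = subst (λ z → takeWhileRev z ≡ ([] , z)) (sym (reverse-++ ys [ opair B R ])) refl
  stop (xpair B R) _ = subst (λ z → takeWhileRev z ≡ ([] , z)) (sym (reverse-++ ys [ xpair B R ])) refl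

reverse-bars : ∀ {g} → AllBar g → AllBar (reverse g)
reverse-bars {[]}    _              = []
reverse-bars {i ∷ g} (i-bar ∷ g-bars) rewrite unfold-reverse i g = All.∷ʳ⁺ (reverse-bars g-bars) i-bar

takeWhileRev-flattenSegments-bars : ∀ ss {g} → AllBar g →
  takeWhileRev (reverse (flattenSegments ss ++ g)) ≡ (g , reverse (flattenSegments ss))
takeWhileRev-flattenSegments-bars ss {g} g-bars
  rewrite reverse-++ (flattenSegments ss) g
        | takeWhileRev-bars (reverse (flattenSegments ss)) (reverse-bars g-bars) (takeWhileRev-flattenSegments ss)
        | reverse-involutive g = refl

phi-B : ∀ m k n ss1 si L → WellFormed (prepend ss1 (prepend [ si ] L)) →
  All (λ s → elemᵇ (m + n) (red s) ≡ false) ss1 →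
  elemᵇ (m + n) (red (extra L)) ≡ false → elemᵇ (m + n) (red si) ≡ true →
  phi m k n (flatten (prepend ss1 (prepend [ si ] L))) ≡
  (if null (removeᵇ (m + n) (red si))
   then bars si ++ opair (blue si) (red (extra L)) ∷ flattenSegments ss1 ++
          clearX (addFirst (m + suc k) (flatten L))
   else bars si ++ opair (blue si) (red (extra L)) ∷ flattenSegments ss1 ++
          opair [ m + suc k ] (removeᵇ (m + n) (red si)) ∷ clearX (flatten L))
phi-B m k n ss1 si L wf@(_ ∷ segments-bars , _) mn∉ss1 mn∉R mn∈Ri =
  trans (cong (phi m k n) (flatten-split ss1 si L)) split
  where
  ss1-bars = All.++⁻ˡ ss1 segments-bars
  si-bars  = All.head (All.++⁻ʳ ss1 segments-bars)
  xRed-split : xRed (flattenSegments ss1 ++ bars si ++ opair (blue si) (red si) ∷ flatten L) ≡ red (extra L)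
  xRed-split = trans (cong xRed (sym (flatten-split ss1 si L))) (xRed-flatten _ wf)
  split : phi m k n (flattenSegments ss1 ++ bars si ++ opair (blue si) (red si) ∷ flatten L) ≡
    (if null (removeᵇ (m + n) (red si))
     then bars si ++ opair (blue si) (red (extra L)) ∷ flattenSegments ss1 ++
            clearX (addFirst (m + suc k) (flatten L))
     else bars si ++ opair (blue si) (red (extra L)) ∷ flattenSegments ss1 ++
            opair [ m + suc k ] (removeᵇ (m + n) (red si)) ∷ clearX (flatten L))
  split rewrite xRed-split | mn∉R
              | findPair-flattenSegments (m + n) ss1 si (flatten L) (si-bars ∷ ss1-bars) mn∉ss1 mn∈Ri
              | takeWhileRev-flattenSegments-bars ss1 si-bars
              | reverse-involutive (flattenSegments ss1) = refl

private
  if-true : ∀ {A : Set} {b} {x y : A} → b ≡ true → (if b then x else y) ≡ x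
  if-true refl = refl

  if-false : ∀ {A : Set} {b} {x y : A} → b ≡ false → (if b then x else y) ≡ y
  if-false refl = refl

phi-B1 : ∀ m k n ss1 si L → WellFormed (prepend ss1 (prepend [ si ] L)) →
  All (λ s → elemᵇ (m + n) (red s) ≡ false) ss1 →
  elemᵇ (m + n) (red (extra L)) ≡ false → elemᵇ (m + n) (red si) ≡ true →
  null (removeᵇ (m + n) (red si)) ≡ true →
  phi m k n (flatten (prepend ss1 (prepend [ si ] L))) ≡
  flatten (prepend (record si { red = red (extra L) } ∷ ss1) (clearRed (addHeadBlue (m + suc k) L)))
phi-B1 m k n ss1 si L wf mn∉ss1 mn∉R mn∈Ri Ri'-null = begin
  phi m k n (flatten (prepend ss1 (prepend [ si ] L)))
    ≡⟨ trans (phi-B m k n ss1 si L wf mn∉ss1 mn∉R mn∈Ri) (if-true Ri'-null) ⟩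
  bars si ++ opair (blue si) (red (extra L)) ∷ flattenSegments ss1 ++ clearX (addFirst (m + suc k) (flatten L))
    ≡⟨ cong (λ z → bars si ++ opair (blue si) (red (extra L)) ∷ flattenSegments ss1 ++ z)
         (trans (cong clearX (addFirst-flatten _ L wf-L)) (clearX-flatten _ (addHeadBlue-wellFormed _ L wf-L))) ⟩
  bars si ++ opair (blue si) (red (extra L)) ∷ flattenSegments ss1 ++ flatten (clearRed (addHeadBlue (m + suc k) L))
    ≡⟨ flatten-prepend-∷ (record si { red = red (extra L) }) ss1 _ ⟨
  flatten (prepend (record si { red = red (extra L) } ∷ ss1) (clearRed (addHeadBlue (m + suc k) L))) ∎
  where
  open ≡-Reasoning
  wf-L = wellFormed-suffix ss1 si L wf

phi-B2 : ∀ m k n ss1 si L → WellFormed (prepend ss1 (prepend [ si ] L)) →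
  All (λ s → elemᵇ (m + n) (red s) ≡ false) ss1 →
  elemᵇ (m + n) (red (extra L)) ≡ false → elemᵇ (m + n) (red si) ≡ true →
  null (removeᵇ (m + n) (red si)) ≡ false →
  phi m k n (flatten (prepend ss1 (prepend [ si ] L))) ≡
  flatten (prepend (record si { red = red (extra L) } ∷ ss1)
    (prepend [ segment [] [ m + suc k ] (removeᵇ (m + n) (red si)) ] (clearRed L)))
phi-B2 m k n ss1 si L wf mn∉ss1 mn∉R mn∈Ri Ri'-nonnull = begin
  phi m k n (flatten (prepend ss1 (prepend [ si ] L)))
    ≡⟨ trans (phi-B m k n ss1 si L wf mn∉ss1 mn∉R mn∈Ri) (if-false Ri'-nonnull) ⟩
  bars si ++ opair (blue si) (red (extra L)) ∷ flattenSegments ss1 ++ new ∷ clearX (flatten L)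
    ≡⟨ cong (λ z → bars si ++ opair (blue si) (red (extra L)) ∷ flattenSegments ss1 ++ new ∷ z)
         (clearX-flatten L (wellFormed-suffix ss1 si L wf)) ⟩
  bars si ++ opair (blue si) (red (extra L)) ∷ flattenSegments ss1 ++ new ∷ flatten (clearRed L)
    ≡⟨ flatten-prepend-∷ (record si { red = red (extra L) }) ss1 _ ⟨
  flatten (prepend (record si { red = red (extra L) } ∷ ss1)
    (prepend [ segment [] [ m + suc k ] (removeᵇ (m + n) (red si)) ] (clearRed L))) ∎
  where
  open ≡-Reasoning
  new = opair [ m + suc k ] (removeᵇ (m + n) (red si))

-- Transfer of validity along the four rules

module _ {m k n : ℕ} where
  open ⇔-Reasoning
  private
    mn = m + suc n
    m' = m + suc k

  reds-A1 : ∀ L → red (extra L) ≡ [ mn ] → ValidReds m (suc n) L ⇔ ValidReds m n (clearRed (addHeadBlue m' L))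
  reds-A1 L R≡ = begin
    ValidReds m (suc n) L                               ≡⟨ cong (λ R → BlocksValid m (suc n) (R ∷ _)) R≡ ⟩
    BlocksValid m (suc n) ([ mn ] ∷ map red (segments L)) ≈⟨ blocks-append here ⟨
    BlocksValid m n ([] ∷ map red (segments L))          ≡⟨ cong (BlocksValid m n) (addHeadBlue-reds m' [] L) ⟨
    ValidReds m n (clearRed (addHeadBlue m' L))          ∎

  valid-A1 : ∀ L → red (extra L) ≡ [ mn ] →
    Valid m k (suc n) L → Valid m (suc k) n (clearRed (addHeadBlue m' L))
  valid-A1 L R≡ v = record
    { barsValid    = to (addHeadBlue-bars m' [] L) (barsValid v)
    ; bluesValid   = to (addHeadBlue-blues [] L) (bluesValid v)
    ; redsValid    = to (reds-A1 L R≡) (redsValid v)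
    ; blueNonEmpty = addHeadBlue-blueNonEmpty m' L (blueNonEmpty v)
    ; redNonEmpty  = to (addHeadBlue-redAll m' L) (redNonEmpty v)
    }

  valid-A1⁻ : ∀ L → red (extra L) ≡ [ mn ] → All (NonEmpty ∘ blue) (segments L) →
    Valid m (suc k) n (clearRed (addHeadBlue m' L)) → Valid m k (suc n) L
  valid-A1⁻ L R≡ blue-ne w = record
    { barsValid    = from (addHeadBlue-bars m' [] L) (barsValid w)
    ; bluesValid   = from (addHeadBlue-blues [] L) (bluesValid w)
    ; redsValid    = from (reds-A1 L R≡) (redsValid w)
    ; blueNonEmpty = blue-ne
    ; redNonEmpty  = from (addHeadBlue-redAll m' L) (redNonEmpty w)
    }

  module _ (L : Layout) (R' : List ℕ) where
    private
      image = prepend [ segment [] [ m' ] R' ] (clearRed L)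

    bars-A2 : ValidBars m L ⇔ ValidBars m image
    bars-A2 = bars-↭ (swap-head [] _ _) ⇔-∘ bars-empty

    blues-A2 : ValidBlues m k L ⇔ ValidBlues m (suc k) image
    blues-A2 = begin
      ValidBlues m k L                                            ≈⟨ blocks-empty ⟩
      BlocksValid m k ([] ∷ map blue (allSegments L))             ≈⟨ blocks-append here ⟩
      BlocksValid m (suc k) ([ m' ] ∷ map blue (allSegments L))   ≈⟨ blocks-↭ (swap-head _ _ _) ⟩
      ValidBlues m (suc k) image                                  ∎

    reds-A2 : red (extra L) ≡ R' ∷ʳ mn → ValidReds m (suc n) L ⇔ ValidReds m n image
    reds-A2 R≡ = begin
      ValidReds m (suc n) L                                     ≡⟨ cong (λ R → BlocksValid m (suc n) (R ∷ _)) R≡ ⟩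
      BlocksValid m (suc n) ((R' ∷ʳ mn) ∷ map red (segments L)) ≈⟨ blocks-append here ⟨
      BlocksValid m n (R' ∷ map red (segments L))               ≈⟨ blocks-empty ⟩
      ValidReds m n image                                       ∎

    valid-A2 : red (extra L) ≡ R' ∷ʳ mn → NonEmpty R' → Valid m k (suc n) L → Valid m (suc k) n image
    valid-A2 R≡ R'≢[] v = record
      { barsValid    = to bars-A2 (barsValid v)
      ; bluesValid   = to blues-A2 (bluesValid v)
      ; redsValid    = to (reds-A2 R≡) (redsValid v)
      ; blueNonEmpty = (λ ()) ∷ blueNonEmpty v
      ; redNonEmpty  = R'≢[] ∷ redNonEmpty v
      }

    valid-A2⁻ : red (extra L) ≡ R' ∷ʳ mn → Valid m (suc k) n image → Valid m k (suc n) L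
    valid-A2⁻ R≡ w = record
      { barsValid    = from bars-A2 (barsValid w)
      ; bluesValid   = from blues-A2 (bluesValid w)
      ; redsValid    = from (reds-A2 R≡) (redsValid w)
      ; blueNonEmpty = All.tail (blueNonEmpty w)
      ; redNonEmpty  = All.tail (redNonEmpty w)
      }

  module _ (ss1 : List Segment) (si : Segment) (L : Layout) where
    private
      preimage = prepend ss1 (prepend [ si ] L)
      si'      = record si { red = red (extra L) }
      image    = prepend (si' ∷ ss1) (clearRed (addHeadBlue m' L))

    bars-B1 : ValidBars m preimage ⇔ ValidBars m image
    bars-B1 = addHeadBlue-bars m' (si' ∷ ss1) L ⇔-∘ bars-↭ (split-↭ bars ss1 si L)

    blues-B1 : ValidBlues m k preimage ⇔ ValidBlues m (suc k) image
    blues-B1 = addHeadBlue-blues (si' ∷ ss1) L ⇔-∘ blocks-↭ (split-↭ blue ss1 si L)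

    reds-B1 : red si ≡ [ mn ] → ValidReds m (suc n) preimage ⇔ ValidReds m n image
    reds-B1 Ri≡ = begin
      ValidReds m (suc n) preimage              ≈⟨ blocks-↭ (split-↭ red ss1 si L) ⟩
      BlocksValid m (suc n) (R ∷ red si ∷ rest) ≡⟨ cong (λ Ri → BlocksValid m (suc n) (R ∷ Ri ∷ rest)) Ri≡ ⟩
      BlocksValid m (suc n) (R ∷ [ mn ] ∷ rest) ≈⟨ blocks-append (there here) ⟨
      BlocksValid m n (R ∷ [] ∷ rest)           ≈⟨ blocks-↭ (swap-head _ _ _) ⟩
      BlocksValid m n ([] ∷ R ∷ rest)           ≡⟨ cong (BlocksValid m n) (addHeadBlue-reds m' (si' ∷ ss1) L) ⟨
      ValidReds m n image                       ∎
      where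
      R    = red (extra L)
      rest = map red (ss1 ++ segments L)

    valid-B1 : red si ≡ [ mn ] → NonEmpty (red (extra L)) → Valid m k (suc n) preimage → Valid m (suc k) n image
    valid-B1 Ri≡ R≢[] v = record
      { barsValid    = to bars-B1 (barsValid v)
      ; bluesValid   = to blues-B1 (bluesValid v)
      ; redsValid    = to (reds-B1 Ri≡) (redsValid v)
      ; blueNonEmpty = All.head blue-ne₂ ∷ All.++⁺ (All.++⁻ˡ ss1 (blueNonEmpty v))
                         (addHeadBlue-blueNonEmpty m' L (All.tail blue-ne₂))
      ; redNonEmpty  = R≢[] ∷ All.++⁺ (All.++⁻ˡ ss1 (redNonEmpty v))
                         (to (addHeadBlue-redAll m' L) (All.tail (All.++⁻ʳ ss1 (redNonEmpty v))))
      }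
      where blue-ne₂ = All.++⁻ʳ ss1 (blueNonEmpty v)

    valid-B1⁻ : red si ≡ [ mn ] → All (NonEmpty ∘ blue) (segments L) →
      Valid m (suc k) n image → Valid m k (suc n) preimage
    valid-B1⁻ Ri≡ blue-ne w = record
      { barsValid    = from bars-B1 (barsValid w)
      ; bluesValid   = from blues-B1 (bluesValid w)
      ; redsValid    = from (reds-B1 Ri≡) (redsValid w)
      ; blueNonEmpty = All.++⁺ (All.++⁻ˡ ss1 blue-ne₁) (All.head (blueNonEmpty w) ∷ blue-ne)
      ; redNonEmpty  = All.++⁺ (All.++⁻ˡ ss1 red-ne₁)
                         (subst NonEmpty (sym Ri≡) (λ ()) ∷ from (addHeadBlue-redAll m' L) (All.++⁻ʳ ss1 red-ne₁))
      }
      where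
      blue-ne₁ = All.tail (blueNonEmpty w)
      red-ne₁  = All.tail (redNonEmpty w)

  module _ (ss1 : List Segment) (si : Segment) (L : Layout) (Ri' : List ℕ) where
    private
      preimage = prepend ss1 (prepend [ si ] L)
      new      = segment [] [ m' ] Ri'
      image    = prepend (record si { red = red (extra L) } ∷ ss1) (prepend [ new ] (clearRed L))

      move-new : ∀ {X : Set} (f : Segment → X) → f new ∷ f (extra L) ∷ f si ∷ map f (ss1 ++ segments L) ↭
        f (extra L) ∷ f si ∷ map f (ss1 ++ new ∷ segments L)
      move-new f = ↭-trans (bury (f new) (f (extra L)) (f si) _)
        (Perm.prep (f (extra L)) (Perm.prep (f si) (↭-sym (map-shift f ss1 new (segments L)))))

    bars-B2 : ValidBars m preimage ⇔ ValidBars m image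
    bars-B2 = bars-↭ (move-new bars) ⇔-∘ (bars-empty ⇔-∘ bars-↭ (split-↭ bars ss1 si L))

    blues-B2 : ValidBlues m k preimage ⇔ ValidBlues m (suc k) image
    blues-B2 = begin
      ValidBlues m k preimage                                        ≈⟨ blocks-↭ (split-↭ blue ss1 si L) ⟩
      BlocksValid m k blues                                          ≈⟨ blocks-empty ⟩
      BlocksValid m k ([] ∷ blues)                                   ≈⟨ blocks-append here ⟩
      BlocksValid m (suc k) ([ m' ] ∷ blues)                         ≈⟨ blocks-↭ (move-new blue) ⟩
      ValidBlues m (suc k) image                                     ∎
      where blues = blue (extra L) ∷ blue si ∷ map blue (ss1 ++ segments L)

    reds-B2 : red si ≡ Ri' ∷ʳ mn → ValidReds m (suc n) preimage ⇔ ValidReds m n image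
    reds-B2 Ri≡ = begin
      ValidReds m (suc n) preimage                     ≈⟨ blocks-↭ (split-↭ red ss1 si L) ⟩
      BlocksValid m (suc n) (R ∷ red si ∷ rest)        ≡⟨ cong (λ Ri → BlocksValid m (suc n) (R ∷ Ri ∷ rest)) Ri≡ ⟩
      BlocksValid m (suc n) (R ∷ (Ri' ∷ʳ mn) ∷ rest)   ≈⟨ blocks-append (there here) ⟨
      BlocksValid m n (R ∷ Ri' ∷ rest)                 ≈⟨ blocks-↭ (Perm.prep R (↭-sym (map-shift red ss1 new (segments L)))) ⟩
      BlocksValid m n (R ∷ map red (ss1 ++ new ∷ segments L)) ≈⟨ blocks-empty ⟩
      ValidReds m n image                              ∎
      where
      R    = red (extra L)
      rest = map red (ss1 ++ segments L)

    valid-B2 : red si ≡ Ri' ∷ʳ mn → NonEmpty Ri' → NonEmpty (red (extra L)) →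
      Valid m k (suc n) preimage → Valid m (suc k) n image
    valid-B2 Ri≡ Ri'≢[] R≢[] v = record
      { barsValid    = to bars-B2 (barsValid v)
      ; bluesValid   = to blues-B2 (bluesValid v)
      ; redsValid    = to (reds-B2 Ri≡) (redsValid v)
      ; blueNonEmpty = All.head blue-ne₂ ∷ All.++⁺ (All.++⁻ˡ ss1 (blueNonEmpty v)) ((λ ()) ∷ All.tail blue-ne₂)
      ; redNonEmpty  = R≢[] ∷ All.++⁺ (All.++⁻ˡ ss1 (redNonEmpty v))
                         (Ri'≢[] ∷ All.tail (All.++⁻ʳ ss1 (redNonEmpty v)))
      }
      where blue-ne₂ = All.++⁻ʳ ss1 (blueNonEmpty v)

    valid-B2⁻ : red si ≡ Ri' ∷ʳ mn → Valid m (suc k) n image → Valid m k (suc n) preimage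
    valid-B2⁻ Ri≡ w = record
      { barsValid    = from bars-B2 (barsValid w)
      ; bluesValid   = from blues-B2 (bluesValid w)
      ; redsValid    = from (reds-B2 Ri≡) (redsValid w)
      ; blueNonEmpty = All.++⁺ (All.++⁻ˡ ss1 blue-ne₁)
                         (All.head (blueNonEmpty w) ∷ All.tail (All.++⁻ʳ ss1 blue-ne₁))
      ; redNonEmpty  = All.++⁺ (All.++⁻ˡ ss1 red-ne₁)
                         (subst NonEmpty (sym Ri≡) (∷ʳ-nonEmpty Ri') ∷ All.tail (All.++⁻ʳ ss1 red-ne₁))
      }
      where
      blue-ne₁ = All.tail (blueNonEmpty w)
      red-ne₁  = All.tail (redNonEmpty w)

-- Singleton blocks {m'} without bars

SingletonsUnbarred : ℕ → Layout → Set
SingletonsUnbarred y L = All (λ s → blue s ≡ [ y ] → bars s ≡ []) (segments L)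

unbarred-fresh₁ : ∀ {y} s → All (_< y) (blue s) → blue s ≡ [ y ] → bars s ≡ []
unbarred-fresh₁ {y} _ blue<y blue≡y = contradiction (subst (y ∈_) (sym blue≡y) (here refl)) (∉-bounded blue<y)

unbarred-fresh : ∀ {y ss} → All (λ s → All (_< y) (blue s)) ss → All (λ s → blue s ≡ [ y ] → bars s ≡ []) ss
unbarred-fresh = All.map (λ {s} → unbarred-fresh₁ s)

∷ʳ-≢-singleton : ∀ {y : ℕ} {xs} → NonEmpty xs → xs ∷ʳ y ≢ [ y ]
∷ʳ-≢-singleton xs≢[] eq = xs≢[] (∷ʳ-injectiveˡ _ [] eq)

unbarred-addHeadBlue : ∀ y L → All (λ s → All (_< y) (blue s)) (segments L) → All (NonEmpty ∘ blue) (segments L) →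
  All (λ s → blue s ≡ [ y ] → bars s ≡ []) (segments (addHeadBlue y L))
unbarred-addHeadBlue y (layout []       x t) _            _        = []
unbarred-addHeadBlue y (layout (s ∷ ss) x t) (_ ∷ fresh) (ne ∷ _) =
  (λ eq → contradiction eq (∷ʳ-≢-singleton ne)) ∷ unbarred-fresh fresh

unbarred-A2 : ∀ {m k n} L R' → Valid m k n L →
  SingletonsUnbarred (m + suc k) (prepend [ segment [] [ m + suc k ] R' ] (clearRed L))
unbarred-A2 L R' v = (λ _ → refl) ∷ unbarred-fresh (All.tail (blueBounds L v))

data BarThenPair (B : List ℕ) : List Item → Set where
  here  : ∀ {b R ys} → IsBar b → BarThenPair B (b ∷ opair B R ∷ ys)
  there : ∀ {i ys} → BarThenPair B ys → BarThenPair B (i ∷ ys)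

barThenPair-++ : ∀ {B} xs {b R ys} → IsBar b → BarThenPair B (xs ++ b ∷ opair B R ∷ ys)
barThenPair-++ []       b-bar = here b-bar
barThenPair-++ (_ ∷ xs) b-bar = there (barThenPair-++ xs b-bar)

barThenPair-bars : ∀ {B t} → AllBar t → ¬ BarThenPair B t
barThenPair-bars (_ ∷ () ∷ _) (here _)
barThenPair-bars (_ ∷ t-bars) (there p) = barThenPair-bars t-bars p

barThenPair-group : ∀ {B B' R rest} g → AllBar g → BarThenPair B (g ++ opair B' R ∷ rest) →
  (g ≢ [] × B' ≡ B) ⊎ BarThenPair B rest
barThenPair-group []          _             (here ())
barThenPair-group []          _             (there p) = inj₂ p
barThenPair-group (_ ∷ [])    _             (here _)  = inj₁ ((λ ()) , refl)
barThenPair-group (_ ∷ _ ∷ _) (_ ∷ () ∷ _) (here _)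
barThenPair-group (_ ∷ g)     (_ ∷ g-bars) (there p) =
  Sum.map₁ (λ (_ , B'≡B) → (λ ()) , B'≡B) (barThenPair-group g g-bars p)

barThenPair-extra : ∀ {B B' R t} g → AllBar g → AllBar t → ¬ BarThenPair B (g ++ xpair B' R ∷ t)
barThenPair-extra []          _             _      (here ())
barThenPair-extra []          _             t-bars (there p) = barThenPair-bars t-bars p
barThenPair-extra (_ ∷ _ ∷ _) (_ ∷ () ∷ _) _      (here _)
barThenPair-extra (_ ∷ g)     (_ ∷ g-bars) t-bars (there p) = barThenPair-extra g g-bars t-bars p

barThenPair-flatten : ∀ {B} L → WellFormed L → BarThenPair B (flatten L) →
  Any (λ s → blue s ≡ B × bars s ≢ []) (segments L)
barThenPair-flatten {B} (layout ss x t) (x-bars ∷ ss-bars , t-bars) = go ss ss-bars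
  where
  go : ∀ ss → All (AllBar ∘ bars) ss → BarThenPair B (flattenSegments ss ++ bars x ++ xpair (blue x) (red x) ∷ t) →
    Any (λ s → blue s ≡ B × bars s ≢ []) ss
  go []       _                  p = contradiction p (barThenPair-extra (bars x) x-bars t-bars)
  go (s ∷ ss) (s-bars ∷ ss-bars) p with barThenPair-group (bars s) s-bars (subst (BarThenPair B) (++-assoc (bars s) _ _) p)
  ... | inj₁ (bars≢[] , blue≡) = here (blue≡ , bars≢[])
  ... | inj₂ p'                = there (go ss ss-bars p')

unbarred⇒¬barred : ∀ {m k n} L → WellFormed L → SingletonsUnbarred (m + suc k) L → ¬ CStarBar m (suc k) n (flatten L)
unbarred⇒¬barred L wf unbarred (_ , xs , b , R , ys , b-bar , eq) =
  All.All¬⇒¬Any (All.map (λ bars≡[] (blue≡ , bars≢[]) → bars≢[] (bars≡[] blue≡)) unbarred)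
    (barThenPair-flatten L wf (subst (BarThenPair _) (sym eq) (barThenPair-++ xs b-bar)))

initLast : ∀ {A : Set} (xs : List A) → xs ≡ [] ⊎ ∃₂ λ ys y → xs ≡ ys ∷ʳ y
initLast []       = inj₁ refl
initLast (x ∷ xs) with initLast xs
... | inj₁ refl            = inj₂ ([] , x , refl)
... | inj₂ (ys , y , refl) = inj₂ (x ∷ ys , y , refl)

¬barred⇒unbarred : ∀ {m k n} L → WellFormed L → CStar m (suc k) n (flatten L) → ¬ CStarBar m (suc k) n (flatten L) →
  SingletonsUnbarred (m + suc k) L
¬barred⇒unbarred {m} {k} (layout ss x t) wf@(_ ∷ ss-bars , _) cstar ¬barred = All.tabulate unbarred
  where
  unbarred : ∀ {s} → s ∈ ss → blue s ≡ [ m + suc k ] → bars s ≡ []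
  unbarred {s} s∈ss blue≡ with ∈-∃++ s∈ss | initLast (bars s)
  ... | _ , _ , _   | inj₁ bars≡[] = bars≡[]
  ... | pre , post , refl | inj₂ (g , b , bars≡) =
    contradiction (cstar , flattenSegments pre ++ g , b , red s , _ , b-bar , split) ¬barred
    where
    b-bar = proj₂ (All.∷ʳ⁻ (subst AllBar bars≡ (All.lookup ss-bars s∈ss)))
    split : flatten (layout (pre ++ s ∷ post) x t) ≡
      (flattenSegments pre ++ g) ++ b ∷ opair [ m + suc k ] (red s) ∷ flatten (layout post x t)
    split = begin
      flatten (layout (pre ++ s ∷ post) x t)
        ≡⟨ flatten-split pre s (layout post x t) ⟩
      flattenSegments pre ++ bars s ++ opair (blue s) (red s) ∷ flatten (layout post x t)
        ≡⟨ cong₂ (λ g' B → flattenSegments pre ++ g' ++ opair B (red s) ∷ flatten (layout post x t))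
             bars≡ blue≡ ⟩
      flattenSegments pre ++ (g ∷ʳ b) ++ opair [ m + suc k ] (red s) ∷ flatten (layout post x t)
        ≡⟨ cong (flattenSegments pre ++_) (++-assoc g [ b ] _) ⟩
      flattenSegments pre ++ g ++ b ∷ opair [ m + suc k ] (red s) ∷ flatten (layout post x t)
        ≡⟨ ++-assoc (flattenSegments pre) g _ ⟨
      (flattenSegments pre ++ g) ++ b ∷ opair [ m + suc k ] (red s) ∷ flatten (layout post x t) ∎
      where open ≡-Reasoning

-- The inverse of φ

splitAtBlue : ℕ → List Segment → List Segment × List Segment
splitAtBlue y []       = [] , []
splitAtBlue y (s ∷ ss) = if elemᵇ y (blue s) then ([] , s ∷ ss) else Product.map₁ (s ∷_) (splitAtBlue y ss)

-- Undo the rule of φ indicated by the first pair whose blue block contains m'.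
module _ (m k n : ℕ) where
  private
    mn = m + n
    m' = m + suc k

  undoB1 : Segment → List Segment → List Segment → Segment → List Item → Layout
  undoB1 s0 ss1 rest x t =
    prepend ss1 (prepend [ record s0 { red = [ mn ] } ] (setExtraRed (red s0) (removeHeadBlue m' (layout rest x t))))

  undoB : Segment → List Segment → List Segment → Segment → List Item → Layout
  undoB s0 ss1 []         x t = undoB1 s0 ss1 [] x t
  undoB s0 ss1 (sj ∷ ss2) x t =
    if null (removeᵇ m' (blue sj))
    then prepend ss1 (prepend [ record s0 { red = red sj ∷ʳ mn } ] (layout ss2 (record x { red = red s0 }) t))
    else undoB1 s0 ss1 (sj ∷ ss2) x t

  phi⁻¹ : Layout → Layout
  phi⁻¹ L@(layout [] x t) = setExtraRed [ mn ] (removeHeadBlue m' L)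
  phi⁻¹ L@(layout (s0 ∷ ss) x t) =
    if elemᵇ m' (blue s0)
    then (if null (removeᵇ m' (blue s0))
          then layout ss (record x { red = red s0 ∷ʳ mn }) t
          else setExtraRed [ mn ] (removeHeadBlue m' L))
    else undoB s0 (proj₁ (splitAtBlue m' ss)) (proj₂ (splitAtBlue m' ss)) x t

splitAtBlue-skip : ∀ y xs ys → All (λ s → elemᵇ y (blue s) ≡ false) xs →
  splitAtBlue y (xs ++ ys) ≡ Product.map₁ (xs ++_) (splitAtBlue y ys)
splitAtBlue-skip y []       ys []                 = refl
splitAtBlue-skip y (s ∷ xs) ys (y∉s ∷ y∉xs) rewrite y∉s | splitAtBlue-skip y xs ys y∉xs = refl

phi⁻¹-A1 : ∀ {m k n} L → Valid m k (suc n) L → red (extra L) ≡ [ m + suc n ] →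
  phi⁻¹ m k (suc n) (clearRed (addHeadBlue (m + suc k) L)) ≡ L
phi⁻¹-A1 {m} {k} (layout [] x t) v R≡ =
  cong₂ (λ b r → layout [] (record x { blue = b ; red = r }) t)
    (removeᵇ-∷ʳ (blue x) (∉-bounded (All.head (blueBounds _ v)))) (sym R≡)
phi⁻¹-A1 {m} {k} (layout (s ∷ ss) x t) v R≡
  rewrite ∈⇒elemᵇ (∈-∷ʳ (m + suc k) (blue s))
        | removeᵇ-∷ʳ (blue s) (∉-bounded (All.head (All.tail (blueBounds _ v))))
        | ≢[]⇒¬null (All.head (blueNonEmpty v)) =
  cong (λ r → layout (s ∷ ss) (record x { red = r }) t) (sym R≡)

phi⁻¹-A2 : ∀ {m k n} L R' → red (extra L) ≡ R' ∷ʳ (m + suc n) →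
  phi⁻¹ m k (suc n) (prepend [ segment [] [ m + suc k ] R' ] (clearRed L)) ≡ L
phi⁻¹-A2 {m} {k} L R' R≡
  rewrite ∈⇒elemᵇ (here {x = m + suc k} {xs = []} refl) | removeᵇ-∷ʳ {m + suc k} [] (λ ()) =
  cong (λ r → layout (segments L) (record (extra L) { red = r }) (trailer L)) (sym R≡)

phi⁻¹-B1 : ∀ {m k n} ss1 si L → Valid m k (suc n) (prepend ss1 (prepend [ si ] L)) → red si ≡ [ m + suc n ] →
  phi⁻¹ m k (suc n) (prepend (record si { red = red (extra L) } ∷ ss1) (clearRed (addHeadBlue (m + suc k) L))) ≡
  prepend ss1 (prepend [ si ] L)
phi⁻¹-B1 {m} {k} {n} ss1 si L v Ri≡ =
  undo L (All.++⁻ˡ ss1 segs-fresh) (All.head (All.++⁻ʳ ss1 segs-fresh)) (All.tail (All.++⁻ʳ ss1 segs-fresh))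
    (All.head (blueBounds _ v)) (All.tail (All.++⁻ʳ ss1 (blueNonEmpty v)))
  where
  m' = m + suc k
  segs-fresh = All.tail (blueBounds _ v)
  undo : ∀ L → All (λ s → All (_< m') (blue s)) ss1 → All (_< m') (blue si) →
    All (λ s → All (_< m') (blue s)) (segments L) → All (_< m') (blue (extra L)) → All (NonEmpty ∘ blue) (segments L) →
    phi⁻¹ m k (suc n) (prepend (record si { red = red (extra L) } ∷ ss1) (clearRed (addHeadBlue m' L))) ≡
    prepend ss1 (prepend [ si ] L)
  undo (layout [] x t) ss1-fresh si-fresh _ x-fresh _
    rewrite ∉⇒¬elemᵇ (∉-bounded si-fresh) | splitAtBlue-skip m' ss1 [] (fresh⇒elemᵇ ss1-fresh)
          | ++-identityʳ ss1 | removeᵇ-∷ʳ (blue x) (∉-bounded x-fresh) =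
    cong (λ r → layout (ss1 ++ record si { red = r } ∷ []) x t) (sym Ri≡)
  undo (layout (s2 ∷ ss3) x t) ss1-fresh si-fresh (s2-fresh ∷ _) _ (s2-nonEmpty ∷ _)
    rewrite ∉⇒¬elemᵇ (∉-bounded si-fresh)
          | splitAtBlue-skip m' ss1 (record s2 { blue = blue s2 ∷ʳ m' } ∷ ss3) (fresh⇒elemᵇ ss1-fresh)
          | ∈⇒elemᵇ (∈-∷ʳ m' (blue s2)) | ++-identityʳ ss1 | removeᵇ-∷ʳ (blue s2) (∉-bounded s2-fresh)
          | ≢[]⇒¬null s2-nonEmpty =
    cong (λ r → layout (ss1 ++ record si { red = r } ∷ s2 ∷ ss3) x t) (sym Ri≡)

phi⁻¹-B2 : ∀ {m k n} ss1 si L Ri' → Valid m k (suc n) (prepend ss1 (prepend [ si ] L)) →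
  red si ≡ Ri' ∷ʳ (m + suc n) →
  phi⁻¹ m k (suc n) (prepend (record si { red = red (extra L) } ∷ ss1)
    (prepend [ segment [] [ m + suc k ] Ri' ] (clearRed L))) ≡
  prepend ss1 (prepend [ si ] L)
phi⁻¹-B2 {m} {k} {n} ss1 si L Ri' v Ri≡ =
  undo (All.++⁻ˡ ss1 segs-fresh) (All.head (All.++⁻ʳ ss1 segs-fresh))
  where
  m' = m + suc k
  segs-fresh = All.tail (blueBounds _ v)
  undo : All (λ s → All (_< m') (blue s)) ss1 → All (_< m') (blue si) →
    phi⁻¹ m k (suc n) (prepend (record si { red = red (extra L) } ∷ ss1)
      (prepend [ segment [] [ m' ] Ri' ] (clearRed L))) ≡ prepend ss1 (prepend [ si ] L)
  undo ss1-fresh si-fresh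
    rewrite ∉⇒¬elemᵇ (∉-bounded si-fresh)
          | splitAtBlue-skip m' ss1 (segment [] [ m' ] Ri' ∷ segments L) (fresh⇒elemᵇ ss1-fresh)
          | ∈⇒elemᵇ (here {x = m'} {xs = []} refl) | ++-identityʳ ss1 | removeᵇ-∷ʳ {m'} [] (λ ()) =
    cong (λ r → layout (ss1 ++ record si { red = r } ∷ segments L) (extra L) (trailer L)) (sym Ri≡)

record PhiImage (m k n : ℕ) (L : Layout) : Set where
  field
    image          : Layout
    phi-flatten    : phi m k (suc n) (flatten L) ≡ flatten image
    image-valid    : Valid m (suc k) n image
    image-red      : red (extra image) ≡ []
    image-unbarred : SingletonsUnbarred (m + suc k) image
    phi⁻¹-image    : phi⁻¹ m k (suc n) image ≡ L

module _ {m k n : ℕ} where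
  private
    mn = m + suc n
    m' = m + suc k

  phiImage-A : ∀ L → Valid m k (suc n) L → elemᵇ mn (red (extra L)) ≡ true → PhiImage m k n L
  phiImage-A L v mn∈R with null (removeᵇ mn (red (extra L))) in R'-null
  ... | true = record
    { image          = clearRed (addHeadBlue m' L)
    ; phi-flatten    = phi-A1 m k (suc n) L wf mn∈R R'-null
    ; image-valid    = valid-A1 L R≡ v
    ; image-red      = refl
    ; image-unbarred = unbarred-addHeadBlue m' L (All.tail (blueBounds L v)) (blueNonEmpty v)
    ; phi⁻¹-image    = phi⁻¹-A1 L v R≡
    }
    where
    wf = valid-wellFormed v
    R≡ : red (extra L) ≡ [ mn ]
    R≡ = trans (sym (All.head (redMax L v) (elemᵇ⇒∈ _ mn∈R))) (cong (_∷ʳ mn) (null⇒≡[] R'-null))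
  ... | false = record
    { image          = prepend [ segment [] [ m' ] R' ] (clearRed L)
    ; phi-flatten    = phi-A2 m k (suc n) L (valid-wellFormed v) mn∈R R'-null
    ; image-valid    = valid-A2 L R' R≡ (¬null⇒≢[] R'-null) v
    ; image-red      = refl
    ; image-unbarred = unbarred-A2 L R' v
    ; phi⁻¹-image    = phi⁻¹-A2 L R' R≡
    }
    where
    R' = removeᵇ mn (red (extra L))
    R≡ : red (extra L) ≡ R' ∷ʳ mn
    R≡ = sym (All.head (redMax L v) (elemᵇ⇒∈ _ mn∈R))

  phiImage-B : ∀ ss1 si L → Valid m k (suc n) (prepend ss1 (prepend [ si ] L)) → NonEmpty (red (extra L)) →
    All (λ s → elemᵇ mn (red s) ≡ false) ss1 → elemᵇ mn (red (extra L)) ≡ false → elemᵇ mn (red si) ≡ true →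
    PhiImage m k n (prepend ss1 (prepend [ si ] L))
  phiImage-B ss1 si L v R≢[] mn∉ss1 mn∉R mn∈Ri with null (removeᵇ mn (red si)) in Ri'-null
  ... | true = record
    { image          = prepend (record si { red = red (extra L) } ∷ ss1) (clearRed (addHeadBlue m' L))
    ; phi-flatten    = phi-B1 m k (suc n) ss1 si L (valid-wellFormed v) mn∉ss1 mn∉R mn∈Ri Ri'-null
    ; image-valid    = valid-B1 ss1 si L Ri≡ R≢[] v
    ; image-red      = refl
    ; image-unbarred = unbarred-fresh₁ si si-fresh ∷
        All.++⁺ (unbarred-fresh (All.++⁻ˡ ss1 segs-fresh))
          (unbarred-addHeadBlue m' L (All.tail (All.++⁻ʳ ss1 segs-fresh)) (All.tail (All.++⁻ʳ ss1 (blueNonEmpty v))))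
    ; phi⁻¹-image    = phi⁻¹-B1 ss1 si L v Ri≡
    }
    where
    segs-fresh = All.tail (blueBounds _ v)
    si-fresh = All.head (All.++⁻ʳ ss1 segs-fresh)
    Ri≡ : red si ≡ [ mn ]
    Ri≡ = trans (sym (All.head (All.++⁻ʳ ss1 (All.tail (redMax _ v))) (elemᵇ⇒∈ _ mn∈Ri)))
            (cong (_∷ʳ mn) (null⇒≡[] Ri'-null))
  ... | false = record
    { image          = prepend (record si { red = red (extra L) } ∷ ss1) (prepend [ segment [] [ m' ] Ri' ] (clearRed L))
    ; phi-flatten    = phi-B2 m k (suc n) ss1 si L (valid-wellFormed v) mn∉ss1 mn∉R mn∈Ri Ri'-null
    ; image-valid    = valid-B2 ss1 si L Ri' Ri≡ (¬null⇒≢[] Ri'-null) R≢[] v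
    ; image-red      = refl
    ; image-unbarred = unbarred-fresh₁ si si-fresh ∷
        All.++⁺ (unbarred-fresh (All.++⁻ˡ ss1 segs-fresh))
          ((λ _ → refl) ∷ unbarred-fresh (All.tail (All.++⁻ʳ ss1 segs-fresh)))
    ; phi⁻¹-image    = phi⁻¹-B2 ss1 si L Ri' v Ri≡
    }
    where
    Ri' = removeᵇ mn (red si)
    segs-fresh = All.tail (blueBounds _ v)
    si-fresh = All.head (All.++⁻ʳ ss1 segs-fresh)
    Ri≡ : red si ≡ Ri' ∷ʳ mn
    Ri≡ = sym (All.head (All.++⁻ʳ ss1 (All.tail (redMax _ v))) (elemᵇ⇒∈ _ mn∈Ri))

  phiImage : ∀ L → Valid m k (suc n) L → NonEmpty (red (extra L)) → PhiImage m k n L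
  phiImage L v R≢[] with elemᵇ mn (red (extra L)) in mn∈?R
  ... | true = phiImage-A L v mn∈?R
  ... | false with Any.map⁻ {f = red} {xs = allSegments L} (blocks-occurs (redsValid v))
  ...   | here mn∈R = contradiction mn∈R (¬elemᵇ⇒∉ mn∈?R)
  ...   | there mn∈ss with firstOccurrence red mn (segments L)
  ...     | inj₁ none = contradiction mn∈ss (all¬elemᵇ⇒¬Any none)
  ...     | inj₂ (ss1 , si , ss2 , eq , mn∉ss1 , mn∈Ri) =
    subst (PhiImage m k n) (sym L≡)
      (phiImage-B ss1 si (layout ss2 (extra L) (trailer L)) (subst (Valid m k (suc n)) L≡ v) R≢[] mn∉ss1 mn∈?R mn∈Ri)
    where
    L≡ : L ≡ prepend ss1 (prepend [ si ] (layout ss2 (extra L) (trailer L)))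
    L≡ = cong (λ ss → layout ss (extra L) (trailer L)) eq

record PhiPreimage (m k n : ℕ) (M : Layout) : Set where
  field
    preimage       : Layout
    preimage-valid : Valid m k (suc n) preimage
    preimage-red   : NonEmpty (red (extra preimage))
    phi-preimage   : phi m k (suc n) (flatten preimage) ≡ flatten M

module _ {m k n : ℕ} where
  private
    mn = m + suc n
    m' = m + suc k

  mn∈∷ʳ : ∀ xs → elemᵇ mn (xs ∷ʳ mn) ≡ true
  mn∈∷ʳ xs = ∈⇒elemᵇ (∈-∷ʳ mn xs)

  preimage-A1 : ∀ L → red (extra L) ≡ [ mn ] → All (NonEmpty ∘ blue) (segments L) →
    Valid m (suc k) n (clearRed (addHeadBlue m' L)) → PhiPreimage m k n (clearRed (addHeadBlue m' L))
  preimage-A1 L R≡ blue-ne w = record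
    { preimage       = L
    ; preimage-valid = v
    ; preimage-red   = subst NonEmpty (sym R≡) (λ ())
    ; phi-preimage   = phi-A1 m k (suc n) L (valid-wellFormed v) (trans (cong (elemᵇ mn) R≡) (mn∈∷ʳ []))
        (trans (cong (null ∘ removeᵇ mn) R≡) (cong null (removeᵇ-∷ʳ {mn} [] (λ ()))))
    }
    where v = valid-A1⁻ L R≡ blue-ne w

  preimage-A2 : ∀ L R' → red (extra L) ≡ R' ∷ʳ mn →
    Valid m (suc k) n (prepend [ segment [] [ m' ] R' ] (clearRed L)) →
    PhiPreimage m k n (prepend [ segment [] [ m' ] R' ] (clearRed L))
  preimage-A2 L R' R≡ w = record
    { preimage       = L
    ; preimage-valid = v
    ; preimage-red   = subst NonEmpty (sym R≡) (∷ʳ-nonEmpty R')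
    ; phi-preimage   = trans
        (phi-A2 m k (suc n) L (valid-wellFormed v) (trans (cong (elemᵇ mn) R≡) (mn∈∷ʳ R'))
          (trans (cong null R'≡) (≢[]⇒¬null (All.head (redNonEmpty w)))))
        (cong (λ R → flatten (prepend [ segment [] [ m' ] R ] (clearRed L))) R'≡)
    }
    where
    v = valid-A2⁻ L R' R≡ w
    R'≡ : removeᵇ mn (red (extra L)) ≡ R'
    R'≡ = trans (cong (removeᵇ mn) R≡) (removeᵇ-∷ʳ R' (∉-bounded (All.head (All.tail (redBounds _ w)))))

  preimage-B1 : ∀ ss1 si L → red si ≡ [ mn ] → All (NonEmpty ∘ blue) (segments L) →
    Valid m (suc k) n (prepend (record si { red = red (extra L) } ∷ ss1) (clearRed (addHeadBlue m' L))) →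
    PhiPreimage m k n (prepend (record si { red = red (extra L) } ∷ ss1) (clearRed (addHeadBlue m' L)))
  preimage-B1 ss1 si L Ri≡ blue-ne w = record
    { preimage       = prepend ss1 (prepend [ si ] L)
    ; preimage-valid = v
    ; preimage-red   = All.head (redNonEmpty w)
    ; phi-preimage   = phi-B1 m k (suc n) ss1 si L (valid-wellFormed v)
        (fresh⇒elemᵇ (All.++⁻ˡ ss1 (All.tail reds<)))
        (∉⇒¬elemᵇ (∉-bounded (All.head reds<)))
        (trans (cong (elemᵇ mn) Ri≡) (mn∈∷ʳ []))
        (trans (cong (null ∘ removeᵇ mn) Ri≡) (cong null (removeᵇ-∷ʳ {mn} [] (λ ()))))
    }
    where
    v = valid-B1⁻ ss1 si L Ri≡ blue-ne w
    reds< = All.tail (redBounds _ w)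

  preimage-B2 : ∀ ss1 si L Ri' → red si ≡ Ri' ∷ʳ mn →
    Valid m (suc k) n (prepend (record si { red = red (extra L) } ∷ ss1) (prepend [ segment [] [ m' ] Ri' ] (clearRed L))) →
    PhiPreimage m k n (prepend (record si { red = red (extra L) } ∷ ss1) (prepend [ segment [] [ m' ] Ri' ] (clearRed L)))
  preimage-B2 ss1 si L Ri' Ri≡ w = record
    { preimage       = prepend ss1 (prepend [ si ] L)
    ; preimage-valid = v
    ; preimage-red   = All.head (redNonEmpty w)
    ; phi-preimage   = trans
        (phi-B2 m k (suc n) ss1 si L (valid-wellFormed v)
          (fresh⇒elemᵇ (All.++⁻ˡ ss1 (All.tail reds<)))
          (∉⇒¬elemᵇ (∉-bounded (All.head reds<)))
          (trans (cong (elemᵇ mn) Ri≡) (mn∈∷ʳ Ri'))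
          (trans (cong null Ri'≡) (≢[]⇒¬null (All.head (All.++⁻ʳ ss1 (All.tail (redNonEmpty w)))))))
        (cong (λ R → flatten (prepend (record si { red = red (extra L) } ∷ ss1) (prepend [ segment [] [ m' ] R ] (clearRed L))))
          Ri'≡)
    }
    where
    v = valid-B2⁻ ss1 si L Ri' Ri≡ w
    reds< = All.tail (redBounds _ w)
    Ri'≡ : removeᵇ mn (red si) ≡ Ri'
    Ri'≡ = trans (cong (removeᵇ mn) Ri≡) (removeᵇ-∷ʳ Ri' (∉-bounded (All.head (All.++⁻ʳ ss1 (All.tail reds<)))))

  private
    segment-≡ : ∀ {s g B R} → bars s ≡ g → blue s ≡ B → red s ≡ R → s ≡ segment g B R
    segment-≡ refl refl refl = refl

    red-cleared : ∀ {x} → red x ≡ [] → x ≡ record x { red = [] }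
    red-cleared = segment-≡ refl refl

    preimage-via : ∀ {M M'} → M ≡ M' → Valid m (suc k) n M →
      (Valid m (suc k) n M' → PhiPreimage m k n M') → PhiPreimage m k n M
    preimage-via refl w f = f w

  phiPreimage-head : ∀ s0 ss x t → Valid m (suc k) n (layout (s0 ∷ ss) x t) → red x ≡ [] →
    SingletonsUnbarred m' (layout (s0 ∷ ss) x t) → elemᵇ m' (blue s0) ≡ true →
    PhiPreimage m k n (layout (s0 ∷ ss) x t)
  phiPreimage-head s0 ss x t w R≡[] unbarred m'∈?B0 with null (removeᵇ m' (blue s0)) in B0'-null
  ... | true =
    preimage-via (cong₂ (λ s0' x' → layout (s0' ∷ ss) x' t)
                   (segment-≡ (All.head unbarred B0≡) B0≡ refl) (red-cleared R≡[])) w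
      (preimage-A2 (layout ss (record x { red = red s0 ∷ʳ mn }) t) (red s0) refl)
    where
    B0≡ : blue s0 ≡ [ m' ]
    B0≡ = trans (sym (All.head (All.tail (blueMax _ w)) (elemᵇ⇒∈ _ m'∈?B0))) (cong (_∷ʳ m') (null⇒≡[] B0'-null))
  ... | false =
    preimage-via (cong₂ (λ s0' x' → layout (s0' ∷ ss) x' t) (segment-≡ refl (sym B0≡) refl) (red-cleared R≡[])) w
      (preimage-A1 (layout (record s0 { blue = removeᵇ m' (blue s0) } ∷ ss) (record x { red = [ mn ] }) t) refl
        (¬null⇒≢[] B0'-null ∷ All.tail (blueNonEmpty w)))
    where
    B0≡ = All.head (All.tail (blueMax _ w)) (elemᵇ⇒∈ _ m'∈?B0)

  phiPreimage-later : ∀ s0 ss x t → Valid m (suc k) n (layout (s0 ∷ ss) x t) → red x ≡ [] →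
    SingletonsUnbarred m' (layout (s0 ∷ ss) x t) → elemᵇ m' (blue s0) ≡ false →
    PhiPreimage m k n (layout (s0 ∷ ss) x t)
  phiPreimage-later s0 ss x t w R≡[] unbarred m'∉B0 with firstOccurrence blue m' ss
  ... | inj₁ none with Any.map⁻ {f = blue} {xs = x ∷ s0 ∷ ss} (blocks-occurs (bluesValid w))
  ...   | here m'∈B =
    preimage-via (cong₂ (λ ss' x' → layout (s0 ∷ ss') x' t) (sym (++-identityʳ ss))
                   (segment-≡ refl (sym (All.head (blueMax _ w) m'∈B)) R≡[])) w
      (preimage-B1 ss (record s0 { red = [ mn ] }) (layout [] (record x { blue = removeᵇ m' (blue x) ; red = red s0 }) t)
        refl [])
  ...   | there (here m'∈B0)  = contradiction m'∈B0 (¬elemᵇ⇒∉ m'∉B0)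
  ...   | there (there m'∈ss) = contradiction m'∈ss (all¬elemᵇ⇒¬Any none)
  phiPreimage-later s0 ss x t w R≡[] unbarred m'∉B0 | inj₂ (ss1 , sj , ss2 , refl , _ , m'∈?Bj)
    with null (removeᵇ m' (blue sj)) in Bj'-null
  ... | true =
    preimage-via (cong₂ (λ sj' x' → layout (s0 ∷ ss1 ++ sj' ∷ ss2) x' t)
                   (segment-≡ (All.head (All.++⁻ʳ ss1 (All.tail unbarred)) Bj≡) Bj≡ refl) (red-cleared R≡[])) w
      (preimage-B2 ss1 (record s0 { red = red sj ∷ʳ mn }) (layout ss2 (record x { red = red s0 }) t) (red sj) refl)
    where
    Bj≡ : blue sj ≡ [ m' ]
    Bj≡ = trans (sym (All.head (All.++⁻ʳ ss1 (All.tail (All.tail (blueMax _ w)))) (elemᵇ⇒∈ _ m'∈?Bj)))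
            (cong (_∷ʳ m') (null⇒≡[] Bj'-null))
  ... | false =
    preimage-via (cong₂ (λ sj' x' → layout (s0 ∷ ss1 ++ sj' ∷ ss2) x' t)
                   (segment-≡ refl (sym Bj≡) refl) (red-cleared R≡[])) w
      (preimage-B1 ss1 (record s0 { red = [ mn ] })
        (layout (record sj { blue = removeᵇ m' (blue sj) } ∷ ss2) (record x { red = red s0 }) t) refl
        (¬null⇒≢[] Bj'-null ∷ All.tail (All.++⁻ʳ ss1 (All.tail (blueNonEmpty w)))))
    where
    Bj≡ = All.head (All.++⁻ʳ ss1 (All.tail (All.tail (blueMax _ w)))) (elemᵇ⇒∈ _ m'∈?Bj)

  phiPreimage : ∀ M → Valid m (suc k) n M → red (extra M) ≡ [] → SingletonsUnbarred m' M → PhiPreimage m k n M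
  phiPreimage (layout [] x t) w R≡[] _ with Any.map⁻ {f = blue} {xs = x ∷ []} (blocks-occurs (bluesValid w))
  ... | here m'∈B =
    preimage-via (cong (λ x' → layout [] x' t) (segment-≡ refl (sym (All.head (blueMax _ w) m'∈B)) R≡[])) w
      (preimage-A1 (layout [] (record x { blue = removeᵇ m' (blue x) ; red = [ mn ] }) t) refl [])
  phiPreimage (layout (s0 ∷ ss) x t) w R≡[] unbarred with elemᵇ m' (blue s0) in m'∈?B0
  ... | true  = phiPreimage-head s0 ss x t w R≡[] unbarred m'∈?B0
  ... | false = phiPreimage-later s0 ss x t w R≡[] unbarred m'∈?B0

module _ {m k n : ℕ} where
  private
    parse-valid : ∀ {k n} s → C m k n s → Valid m k n (parse s)
    parse-valid s c = let wf , eq = flatten-parse s (C.shape c) in C⇒valid (parse s) wf (subst (C m _ _) (sym eq) c)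

    flatten-parse-C : ∀ {k n} s → C m k n s → flatten (parse s) ≡ s
    flatten-parse-C s c = proj₂ (flatten-parse s (C.shape c))

    xRed-parse : ∀ {k n} s → C m k n s → xRed s ≡ red (extra (parse s))
    xRed-parse s c = trans (cong xRed (sym (flatten-parse-C s c))) (xRed-flatten _ (valid-wellFormed (parse-valid s c)))

    imageOf : ∀ α → CRStar m k (suc n) α → PhiImage m k n (parse α)
    imageOf α (c , R≢[]) = phiImage (parse α) (parse-valid α c) (R≢[] ∘ trans (xRed-parse α c))

    phi-imageOf : ∀ α (cα : CRStar m k (suc n) α) → phi m k (suc n) α ≡ flatten (PhiImage.image (imageOf α cα))
    phi-imageOf α cα =
      trans (cong (phi m k (suc n)) (sym (flatten-parse-C α (proj₁ cα)))) (PhiImage.phi-flatten (imageOf α cα))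

  phi-into : ∀ α → CRStar m k (suc n) α →
    CStar m (suc k) n (phi m k (suc n) α) × ¬ CStarBar m (suc k) n (phi m k (suc n) α)
  phi-into α cα rewrite phi-imageOf α cα =
    (valid⇒C image image-valid , trans (xRed-flatten image wf) image-red) , unbarred⇒¬barred image wf image-unbarred
    where
    open PhiImage (imageOf α cα)
    wf = valid-wellFormed image-valid

  phi-injective : ∀ α β → CRStar m k (suc n) α → CRStar m k (suc n) β →
    phi m k (suc n) α ≡ phi m k (suc n) β → α ≡ β
  phi-injective α β cα cβ eq = begin
    α                                             ≡⟨ flatten-parse-C α (proj₁ cα) ⟨
    flatten (parse α)                             ≡⟨ cong flatten (PhiImage.phi⁻¹-image Iα) ⟨
    flatten (phi⁻¹ m k (suc n) (PhiImage.image Iα)) ≡⟨ cong (flatten ∘ phi⁻¹ m k (suc n)) images≡ ⟩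
    flatten (phi⁻¹ m k (suc n) (PhiImage.image Iβ)) ≡⟨ cong flatten (PhiImage.phi⁻¹-image Iβ) ⟩
    flatten (parse β)                             ≡⟨ flatten-parse-C β (proj₁ cβ) ⟩
    β                                             ∎
    where
    open ≡-Reasoning
    Iα = imageOf α cα
    Iβ = imageOf β cβ
    images≡ : PhiImage.image Iα ≡ PhiImage.image Iβ
    images≡ = flatten-injective (valid-wellFormed (PhiImage.image-valid Iα)) (valid-wellFormed (PhiImage.image-valid Iβ))
      (trans (sym (phi-imageOf α cα)) (trans eq (phi-imageOf β cβ)))

  phi-onto : ∀ γ → CStar m (suc k) n γ → ¬ CStarBar m (suc k) n γ →
    Σ (List Item) λ α → CRStar m k (suc n) α × phi m k (suc n) α ≡ γ
  phi-onto γ cγ@(c , R≡[]) ¬barred =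
    flatten preimage ,
    (valid⇒C preimage preimage-valid , preimage-red ∘ trans (sym (xRed-flatten preimage (valid-wellFormed preimage-valid)))) ,
    trans phi-preimage (flatten-parse-C γ c)
    where
    v = parse-valid γ c
    eq = flatten-parse-C γ c
    unbarred = ¬barred⇒unbarred (parse γ) (valid-wellFormed v) (subst (CStar m (suc k) n) (sym eq) cγ)
                 (¬barred ∘ subst (CStarBar m (suc k) n) eq)
    open PhiPreimage (phiPreimage (parse γ) v (trans (sym (xRed-parse γ c)) R≡[]) unbarred)

mainTheorem4 : (m k n : ℕ) →
    -- φ maps 𝒞_{n+1}^k(m,R*) into 𝒞_n^{k+1}(m,*) ∖ 𝒞_n^{k+1}(m,*,|m+k+1)
    ((α : List Item) → CRStar m k (suc n) α →
       CStar m (suc k) n (phi m k (suc n) α) × ¬ CStarBar m (suc k) n (phi m k (suc n) α))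
    -- φ is injective on 𝒞_{n+1}^k(m,R*)
    × ((α β : List Item) → CRStar m k (suc n) α → CRStar m k (suc n) β →
       phi m k (suc n) α ≡ phi m k (suc n) β → α ≡ β)
    -- φ is onto 𝒞_n^{k+1}(m,*) ∖ 𝒞_n^{k+1}(m,*,|m+k+1)
    × ((γ : List Item) → CStar m (suc k) n γ → ¬ CStarBar m (suc k) n γ →
       Σ (List Item) λ α → CRStar m k (suc n) α × phi m k (suc n) α ≡ γ)
mainTheorem4 m k n = phi-into , phi-injective , phi-onto
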